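{- For $n\ge3$ let $B_n$ be the number of permutations $\sigma\in S_n$ such that $\mathrm{runsort}(\sigma)$ has a descent at position $2$. Then $B_3=2$, $B_n=(n-1)!+(n-2)B_{n-1}$ for all $n\ge4$, and consequently \[ B_n=(n-2)!\,(n+1)\,\frac{n-2}{2}\qquad(n\ge3). \]
   Context: For $\tau\in S_n$ in one-line notation, $\tau$ has a descent at position $k$ if $\tau(k)>\tau(k+1)$. The runs of $\sigma$ are its maximal increasing contiguous subwords, and $\mathrm{runsort}(\sigma)$ is obtained by rearranging the runs of $\sigma$ in increasing order of their first entries. -}

module Defs where

open import Data.Nat using (ℕ; zero; suc; _<ᵇ_)
open import Data.Bool using (Bool; true; false; _∧_; if_then_else_)
open import Data.List using (List; []; _∷_; concat; map; filter; length; allFin; concatMap)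
open import Data.Fin using (Fin; toℕ)
open import Data.Vec using (Vec; []; _∷_; toList)
open import Data.Unit using (⊤)
open import Relation.Nullary.Decidable using (Dec)
open import Data.Bool using (T; T?)

words : (n m : ℕ) → List (Vec (Fin n) m)
words n zero    = [] ∷ []
words n (suc m) = concatMap (λ i → map (i ∷_) (words n m)) (allFin n)

_≡ᵇ_ : ℕ → ℕ → Bool
zero  ≡ᵇ zero  = true
zero  ≡ᵇ suc _ = false
suc _ ≡ᵇ zero  = false
suc a ≡ᵇ suc b = a ≡ᵇ b

notElem : ℕ → List ℕ → Bool
notElem x []       = true
notElem x (y ∷ ys) = if x ≡ᵇ y then false else notElem x ys

distinct : List ℕ → Bool
distinct []       = true
distinct (x ∷ xs) = notElem x xs ∧ distinct xs

-- One-line notation of a word over Fin n, using values 1..n.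
oneLine : ∀ {n m} → Vec (Fin n) m → List ℕ
oneLine v = map (λ i → suc (toℕ i)) (toList v)

isPerm : ∀ {n} → Vec (Fin n) n → Bool
isPerm v = distinct (oneLine v)

-- Runs: maximal increasing contiguous subwords.
-- prepend x to the run decomposition of the following word.
consRun : ℕ → List (List ℕ) → List (List ℕ)
consRun x []                    = (x ∷ []) ∷ []
consRun x ([] ∷ rs)             = (x ∷ []) ∷ rs   -- never occurs
consRun x ((y ∷ r) ∷ rs) = if x <ᵇ y then (x ∷ y ∷ r) ∷ rs else (x ∷ []) ∷ (y ∷ r) ∷ rs

runs : List ℕ → List (List ℕ)
runs []       = []
runs (x ∷ xs) = consRun x (runs xs)

-- first entry of a run (runs are nonempty)
firstEntry : List ℕ → ℕ
firstEntry []      = 0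
firstEntry (x ∷ _) = x

insertRun : List ℕ → List (List ℕ) → List (List ℕ)
insertRun r []        = r ∷ []
insertRun r (s ∷ ss)  = if firstEntry r <ᵇ firstEntry s then r ∷ s ∷ ss else s ∷ insertRun r ss

sortRuns : List (List ℕ) → List (List ℕ)
sortRuns []       = []
sortRuns (r ∷ rs) = insertRun r (sortRuns rs)

runsort : List ℕ → List ℕ
runsort σ = concat (sortRuns (runs σ))

-- τ has a descent at (1-indexed) position 2: τ(2) > τ(3).
descentAt2 : List ℕ → Bool
descentAt2 (a ∷ b ∷ c ∷ _) = c <ᵇ b
descentAt2 _               = false

B : ℕ → ℕ
B n = length (filter (λ v → T? (isPerm v ∧ descentAt2 (runsort (oneLine v)))) (words n n))

-- In σ ∈ Sₙ, runsort σ starts with the run of 1, followed by the run whose head is the smallest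
-- of the other heads; that is 2 unless 2 directly follows 1. Hence runsort σ has a descent at
-- position 2 exactly when the run of 1 is 1 y with y ≥ 3, i.e. when σ ends with a factor 1 y
-- (y ≥ 3) or contains a factor 1 y z (2 ≤ z < y). Each of these (n - 2) + (n - 2)(n - 1)/2
-- factors occurs in (n - 2)! permutations, which gives the closed form; the recurrence follows
-- from it. Permutations are handled as words of distinct letters, counted letter by letter.

module Submission where

open import Defs
open import Data.Nat using (ℕ; zero; suc; _+_; _*_; _∸_; _≤_; _<_; _/_; _!; _<ᵇ_; z≤n; s≤s; pred)
open import Data.Nat.Properties
open import Data.Nat.DivMod using (m*n/n≡m)
open import Data.Nat.ListAction using (sum)
open import Data.Nat.ListAction.Properties using (sum-++)
open import Data.Nat.Solver using (module +-*-Solver)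
open import Data.Bool using (Bool; true; false; _∧_; _∨_; if_then_else_; T; T?)
open import Data.Bool.Properties using (∧-zeroʳ; ∧-identityʳ; ∨-identityʳ; ∧-assoc)
open import Data.List using (List; []; _∷_; concat; map; filter; length; allFin; concatMap; tabulate; _++_)
open import Data.List.Properties using (length-++; map-++; map-tabulate; map-cong; map-∘)
open import Data.List.Relation.Unary.All as All using (All; []; _∷_)
open import Data.List.Relation.Unary.All.Properties using (++⁺; ++⁻ˡ; ++⁻ʳ)
open import Data.List.Relation.Unary.Any using (here; there)
open import Data.List.Membership.Propositional using (_∈_; _∉_)
open import Data.Fin using (Fin; toℕ)
open import Data.Vec using (Vec; _∷_)
open import Data.Product using (_×_; _,_; proj₁; proj₂; ∃; ∃₂)
open import Data.Sum using (_⊎_; inj₁; inj₂)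
open import Data.Unit using (⊤; tt)
open import Data.Empty using (⊥; ⊥-elim)
open import Function using (_∘_; id)
open import Relation.Binary.PropositionalEquality
open +-*-Solver using (solve; _:+_; _:*_; _:=_; con)

𝟙 : Bool → ℕ
𝟙 true  = 1
𝟙 false = 0

𝟙-∧ : ∀ a b → 𝟙 (a ∧ b) ≡ 𝟙 a * 𝟙 b
𝟙-∧ true  b = sym (+-identityʳ (𝟙 b))
𝟙-∧ false b = refl

𝟙≡0⇒false : ∀ {b} → 𝟙 b ≡ 0 → b ≡ false
𝟙≡0⇒false {false} _ = refl

𝟙-*-cong : ∀ b {x y} → (b ≡ true → x ≡ y) → 𝟙 b * x ≡ 𝟙 b * y
𝟙-*-cong true  h = cong (1 *_) (h refl)
𝟙-*-cong false h = refl

∧-true : ∀ {a b} → a ∧ b ≡ true → a ≡ true × b ≡ true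
∧-true {true} {true} _ = refl , refl

∨-true : ∀ {a b} → a ∨ b ≡ true → a ≡ true ⊎ b ≡ true
∨-true {true}  _ = inj₁ refl
∨-true {false} e = inj₂ e

∨-false : ∀ {a b} → a ∨ b ≡ false → a ≡ false × b ≡ false
∨-false {false} {false} _ = refl , refl

false≢true : false ≢ true
false≢true ()

≡ᵇ-refl : ∀ x → (x ≡ᵇ x) ≡ true
≡ᵇ-refl zero    = refl
≡ᵇ-refl (suc x) = ≡ᵇ-refl x

≡ᵇ-true⇒≡ : ∀ x y → (x ≡ᵇ y) ≡ true → x ≡ y
≡ᵇ-true⇒≡ zero    zero    _ = refl
≡ᵇ-true⇒≡ (suc x) (suc y) e = cong suc (≡ᵇ-true⇒≡ x y e)

≡ᵇ-sym : ∀ x y → (x ≡ᵇ y) ≡ (y ≡ᵇ x)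
≡ᵇ-sym zero    zero    = refl
≡ᵇ-sym zero    (suc y) = refl
≡ᵇ-sym (suc x) zero    = refl
≡ᵇ-sym (suc x) (suc y) = ≡ᵇ-sym x y

≢⇒≡ᵇ-false : ∀ {x y} → x ≢ y → (x ≡ᵇ y) ≡ false
≢⇒≡ᵇ-false {zero}  {zero}  ne = ⊥-elim (ne refl)
≢⇒≡ᵇ-false {zero}  {suc y} ne = refl
≢⇒≡ᵇ-false {suc x} {zero}  ne = refl
≢⇒≡ᵇ-false {suc x} {suc y} ne = ≢⇒≡ᵇ-false (ne ∘ cong suc)

<ᵇ⇒<′ : ∀ {m n} → (m <ᵇ n) ≡ true → m < n
<ᵇ⇒<′ {m} {n} e = <ᵇ⇒< m n (subst T (sym e) tt)

<⇒<ᵇ′ : ∀ {m n} → m < n → (m <ᵇ n) ≡ true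
<⇒<ᵇ′ {m} {n} lt with m <ᵇ n | <⇒<ᵇ lt
... | true | _ = refl

≮ᵇ⇒≥ : ∀ {m n} → (m <ᵇ n) ≡ false → n ≤ m
≮ᵇ⇒≥ e = ≮⇒≥ (λ lt → false≢true (trans (sym e) (<⇒<ᵇ′ lt)))

≥⇒≮ᵇ : ∀ {m n} → n ≤ m → (m <ᵇ n) ≡ false
≥⇒≮ᵇ {m} {n} le with m <ᵇ n in e
... | true  = ⊥-elim (<⇒≱ (<ᵇ⇒<′ e) le)
... | false = refl

-- Finite sums over an initial segment of ℕ

sumBelow : ℕ → (ℕ → ℕ) → ℕ
sumBelow zero    f = 0
sumBelow (suc n) f = f 0 + sumBelow n (f ∘ suc)

syntax sumBelow n (λ j → e) = ∑[ j < n ] e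

∑-cong : ∀ n {f g : ℕ → ℕ} → (∀ j → j < n → f j ≡ g j) → sumBelow n f ≡ sumBelow n g
∑-cong zero    e = refl
∑-cong (suc n) e = cong₂ _+_ (e 0 (s≤s z≤n)) (∑-cong n (λ j j<n → e (suc j) (s≤s j<n)))

∑-zero : ∀ n {f : ℕ → ℕ} → (∀ j → f j ≡ 0) → sumBelow n f ≡ 0
∑-zero zero    e = refl
∑-zero (suc n) e = cong₂ _+_ (e 0) (∑-zero n (e ∘ suc))

∑-+ : ∀ n (f g : ℕ → ℕ) → ∑[ j < n ] (f j + g j) ≡ sumBelow n f + sumBelow n g
∑-+ zero    f g = refl
∑-+ (suc n) f g = trans (cong (f 0 + g 0 +_) (∑-+ n (f ∘ suc) (g ∘ suc)))
  (solve 4 (λ a b c d → a :+ b :+ (c :+ d) := a :+ c :+ (b :+ d)) refl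
    (f 0) (g 0) (sumBelow n (f ∘ suc)) (sumBelow n (g ∘ suc)))

∑-*ˡ : ∀ n c (f : ℕ → ℕ) → ∑[ j < n ] (c * f j) ≡ c * sumBelow n f
∑-*ˡ zero    c f = sym (*-zeroʳ c)
∑-*ˡ (suc n) c f = trans (cong (c * f 0 +_) (∑-*ˡ n c (f ∘ suc))) (sym (*-distribˡ-+ c (f 0) _))

∑-*ʳ : ∀ n c (f : ℕ → ℕ) → ∑[ j < n ] (f j * c) ≡ sumBelow n f * c
∑-*ʳ n c f = trans (∑-cong n (λ j _ → *-comm (f j) c)) (trans (∑-*ˡ n c f) (*-comm c _))

∑-one : ∀ n → ∑[ j < n ] 1 ≡ n
∑-one zero    = refl
∑-one (suc n) = cong suc (∑-one n)

∑-snoc : ∀ n f → sumBelow (suc n) f ≡ sumBelow n f + f n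
∑-snoc zero    f = +-comm (f 0) 0
∑-snoc (suc n) f = trans (cong (f 0 +_) (∑-snoc n (f ∘ suc))) (sym (+-assoc (f 0) _ _))

∑-δ : ∀ n y (g : ℕ → ℕ) → y < n → ∑[ j < n ] (𝟙 (j ≡ᵇ y) * g j) ≡ g y
∑-δ (suc n) zero    g _ = trans (cong₂ _+_ (+-identityʳ (g 0)) (∑-zero n (λ _ → refl))) (+-identityʳ (g 0))
∑-δ (suc n) (suc y) g (s≤s y<n) = ∑-δ n y (g ∘ suc) y<n

∑-δ′ : ∀ n y (g : ℕ → ℕ) → y < n → ∑[ j < n ] (𝟙 (y ≡ᵇ j) * g j) ≡ g y
∑-δ′ n y g y<n = trans (∑-cong n (λ j _ → cong (λ b → 𝟙 b * g j) (≡ᵇ-sym y j))) (∑-δ n y g y<n)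

∑-single : ∀ n y (t : ℕ → ℕ) → y < n → (∀ j → (j ≡ᵇ y) ≡ false → t j ≡ 0) → sumBelow n t ≡ t y
∑-single n y t y<n h = trans (∑-cong n pt) (∑-δ n y t y<n)
  where
  pt : ∀ j → j < n → t j ≡ 𝟙 (j ≡ᵇ y) * t j
  pt j _ with j ≡ᵇ y in e
  ... | true  = sym (+-identityʳ (t j))
  ... | false = h j e

∑≡0⇒≡0 : ∀ n (f : ℕ → ℕ) → sumBelow n f ≡ 0 → ∀ j → j < n → f j ≡ 0
∑≡0⇒≡0 (suc n) f e zero    _         = m+n≡0⇒m≡0 (f 0) e
∑≡0⇒≡0 (suc n) f e (suc j) (s≤s j<n) = ∑≡0⇒≡0 n (f ∘ suc) (m+n≡0⇒n≡0 (f 0) e) j j<n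

∑-count-< : ∀ m j → j ≤ m → ∑[ i < m ] 𝟙 (i <ᵇ j) ≡ j
∑-count-< zero    zero    _        = refl
∑-count-< (suc m) zero    _        = ∑-zero m (λ _ → refl)
∑-count-< (suc m) (suc j) (s≤s le) = cong suc (∑-count-< m j le)

-- Sums over all words with letters in 1..n

sumWords : ℕ → ℕ → (List ℕ → ℕ) → ℕ
sumWords n zero    f = f []
sumWords n (suc m) f = ∑[ j < n ] sumWords n m (λ l → f (suc j ∷ l))

InRange : ℕ → ℕ → Set
InRange n x = 1 ≤ x × x ≤ n

Letters : ℕ → List ℕ → Set
Letters n = All (InRange n)

length-filter : ∀ {A : Set} (b : A → Bool) (xs : List A) →
  length (filter (λ v → T? (b v)) xs) ≡ sum (map (𝟙 ∘ b) xs)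
length-filter b [] = refl
length-filter b (x ∷ xs) with b x
... | true  = cong suc (length-filter b xs)
... | false = length-filter b xs

sum-map-concatMap : ∀ {A B : Set} (h : B → ℕ) (g : A → List B) (xs : List A) →
  sum (map h (concatMap g xs)) ≡ sum (map (λ a → sum (map h (g a))) xs)
sum-map-concatMap h g []       = refl
sum-map-concatMap h g (x ∷ xs) = begin
  sum (map h (g x ++ concatMap g xs))                   ≡⟨ cong sum (map-++ h (g x) (concatMap g xs)) ⟩
  sum (map h (g x) ++ map h (concatMap g xs))           ≡⟨ sum-++ (map h (g x)) _ ⟩
  sum (map h (g x)) + sum (map h (concatMap g xs))      ≡⟨ cong (sum (map h (g x)) +_) (sum-map-concatMap h g xs) ⟩
  sum (map h (g x)) + sum (map (λ a → sum (map h (g a))) xs) ∎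
  where open ≡-Reasoning

sum-allFin : ∀ n (g : ℕ → ℕ) → sum (map (g ∘ toℕ) (allFin n)) ≡ sumBelow n g
sum-allFin n g = trans (cong sum (map-tabulate {n = n} id (g ∘ toℕ))) (go n g)
  where
  go : ∀ n (g : ℕ → ℕ) → sum (tabulate {n = n} (g ∘ toℕ)) ≡ sumBelow n g
  go zero    g = refl
  go (suc n) g = cong (g 0 +_) (go n (g ∘ suc))

sum-words≡sumWords : ∀ n m (f : List ℕ → ℕ) → sum (map (f ∘ oneLine) (words n m)) ≡ sumWords n m f
sum-words≡sumWords n zero    f = +-identityʳ _
sum-words≡sumWords n (suc m) f = begin
  sum (map h (concatMap (λ i → map (i ∷_) (words n m)) (allFin n)))
    ≡⟨ sum-map-concatMap h (λ i → map (i ∷_) (words n m)) (allFin n) ⟩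
  sum (map (λ i → sum (map h (map (i ∷_) (words n m)))) (allFin n))
    ≡⟨ cong sum (map-cong (λ i → trans (cong sum (sym (map-∘ (words n m))))
                                        (sum-words≡sumWords n m (λ l → f (suc (toℕ i) ∷ l)))) (allFin n)) ⟩
  sum (map (λ i → sumWords n m (λ l → f (suc (toℕ i) ∷ l))) (allFin n))
    ≡⟨ sum-allFin n (λ j → sumWords n m (λ l → f (suc j ∷ l))) ⟩
  sumWords n (suc m) f ∎
  where
  open ≡-Reasoning
  h : Vec (Fin n) (suc m) → ℕ
  h = f ∘ oneLine

B≡sumWords : ∀ n → B n ≡ sumWords n n (λ l → 𝟙 (distinct l ∧ descentAt2 (runsort l)))
B≡sumWords n = trans (length-filter (λ v → isPerm v ∧ descentAt2 (runsort (oneLine v))) (words n n))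
                     (sum-words≡sumWords n n (λ l → 𝟙 (distinct l ∧ descentAt2 (runsort l))))

sumWords-cong : ∀ n m {f g : List ℕ → ℕ} → (∀ l → Letters n l → length l ≡ m → f l ≡ g l) →
  sumWords n m f ≡ sumWords n m g
sumWords-cong n zero    e = e [] [] refl
sumWords-cong n (suc m) e = ∑-cong n (λ j j<n → sumWords-cong n m
  (λ l ls len → e (suc j ∷ l) ((s≤s z≤n , j<n) ∷ ls) (cong suc len)))

sumWords-0 : ∀ n m → sumWords n m (λ _ → 0) ≡ 0
sumWords-0 n zero    = refl
sumWords-0 n (suc m) = ∑-zero n (λ _ → sumWords-0 n m)

sumWords-zero : ∀ n m {f : List ℕ → ℕ} → (∀ l → Letters n l → length l ≡ m → f l ≡ 0) → sumWords n m f ≡ 0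
sumWords-zero n m e = trans (sumWords-cong n m e) (sumWords-0 n m)

sumWords-+ : ∀ n m (f g : List ℕ → ℕ) → sumWords n m (λ l → f l + g l) ≡ sumWords n m f + sumWords n m g
sumWords-+ n zero    f g = refl
sumWords-+ n (suc m) f g = trans (∑-cong n (λ j _ → sumWords-+ n m _ _)) (∑-+ n _ _)

sumWords-*ˡ : ∀ n m c (f : List ℕ → ℕ) → sumWords n m (λ l → c * f l) ≡ c * sumWords n m f
sumWords-*ˡ n zero    c f = refl
sumWords-*ˡ n (suc m) c f = trans (∑-cong n (λ j _ → sumWords-*ˡ n m c _)) (∑-*ˡ n c _)

sumWords-∑ : ∀ n m k (f : ℕ → List ℕ → ℕ) →
  sumWords n m (λ l → ∑[ j < k ] f j l) ≡ ∑[ j < k ] sumWords n m (f j)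
sumWords-∑ n m zero    f = sumWords-0 n m
sumWords-∑ n m (suc k) f = trans (sumWords-+ n m (f 0) (λ l → ∑[ j < k ] f (suc j) l))
                                 (cong (sumWords n m (f 0) +_) (sumWords-∑ n m k (f ∘ suc)))

sumWords≡0⇒≡0 : ∀ n m (f : List ℕ → ℕ) → sumWords n m f ≡ 0 → ∀ l → Letters n l → length l ≡ m → f l ≡ 0
sumWords≡0⇒≡0 n zero    f e [] _ _ = e
sumWords≡0⇒≡0 n (suc m) f e (suc x ∷ l) ((_ , x<n) ∷ ls) len =
  sumWords≡0⇒≡0 n m (λ l → f (suc x ∷ l)) (∑≡0⇒≡0 n _ e x x<n) l ls (suc-injective len)

-- Counting words of distinct letters

freshFrom : List ℕ → List ℕ → Bool
freshFrom V []       = true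
freshFrom V (x ∷ xs) = notElem x V ∧ freshFrom (x ∷ V) xs

disjoint : List ℕ → List ℕ → Bool
disjoint []       V = true
disjoint (x ∷ xs) V = notElem x V ∧ disjoint xs V

falling : ℕ → ℕ → ℕ
falling k zero    = 1
falling k (suc m) = k * falling (pred k) m

falling-≡0 : ∀ k m → k < m → falling k m ≡ 0
falling-≡0 zero    (suc m) _        = refl
falling-≡0 (suc k) (suc m) (s≤s lt) = trans (cong (suc k *_) (falling-≡0 k m lt)) (*-zeroʳ (suc k))

falling-! : ∀ k → falling k k ≡ k !
falling-! zero    = refl
falling-! (suc k) = cong (suc k *_) (falling-! k)

notElem⇒∉ : ∀ {x xs} → notElem x xs ≡ true → x ∉ xs
notElem⇒∉ {x} {y ∷ xs} ne (here refl) rewrite ≡ᵇ-refl x = false≢true ne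
notElem⇒∉ {x} {y ∷ xs} ne (there m) with x ≡ᵇ y
... | true  = false≢true ne
... | false = notElem⇒∉ ne m

notElem-++ : ∀ x u V → notElem x (u ++ V) ≡ notElem x u ∧ notElem x V
notElem-++ x []      V = refl
notElem-++ x (y ∷ u) V with x ≡ᵇ y
... | true  = refl
... | false = notElem-++ x u V

disjoint-∷ʳ : ∀ xs y V → disjoint xs (y ∷ V) ≡ notElem y xs ∧ disjoint xs V
disjoint-∷ʳ []       y V = refl
disjoint-∷ʳ (x ∷ xs) y V rewrite ≡ᵇ-sym y x with x ≡ᵇ y
... | true  = refl
... | false rewrite disjoint-∷ʳ xs y V with notElem x V | notElem y xs
... | true  | _     = refl
... | false | true  = refl
... | false | false = refl

disjoint-∷ʳ⁻ : ∀ xs y V → disjoint xs (y ∷ V) ≡ true → disjoint xs V ≡ true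
disjoint-∷ʳ⁻ xs y V e rewrite disjoint-∷ʳ xs y V = proj₂ (∧-true e)

notElem-∷-≢ : ∀ x y ys → (x ≡ᵇ y) ≡ false → notElem x (y ∷ ys) ≡ notElem x ys
notElem-∷-≢ x y ys e rewrite e = refl

disjoint-[] : ∀ l → disjoint l [] ≡ true
disjoint-[] []      = refl
disjoint-[] (x ∷ l) = disjoint-[] l

distinct-++ : ∀ u V → distinct u ≡ true → distinct V ≡ true → disjoint u V ≡ true → distinct (u ++ V) ≡ true
distinct-++ []      V _  dV _  = dV
distinct-++ (x ∷ u) V du dV dj rewrite notElem-++ x u V
  with ∧-true {notElem x u} du | ∧-true {notElem x V} dj
... | xu , du′ | xV , dj′ rewrite xu | xV = distinct-++ u V du′ dV dj′

distinct-++⁻ʳ : ∀ p q → distinct (p ++ q) ≡ true → distinct q ≡ true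
distinct-++⁻ʳ []      q d = d
distinct-++⁻ʳ (x ∷ p) q d = distinct-++⁻ʳ p q (proj₂ (∧-true {notElem x (p ++ q)} d))

freshFrom≡distinct∧disjoint : ∀ V l → freshFrom V l ≡ distinct l ∧ disjoint l V
freshFrom≡distinct∧disjoint V []       = refl
freshFrom≡distinct∧disjoint V (x ∷ xs)
  rewrite freshFrom≡distinct∧disjoint (x ∷ V) xs | disjoint-∷ʳ xs x V
  with notElem x V | distinct xs | notElem x xs
... | true  | true  | true  = refl
... | true  | true  | false = refl
... | true  | false | true  = refl
... | true  | false | false = refl
... | false | true  | true  = refl
... | false | true  | false = refl
... | false | false | true  = refl
... | false | false | false = refl

∑-notElem+length : ∀ n V → distinct V ≡ true → Letters n V → ∑[ j < n ] 𝟙 (notElem (suc j) V) + length V ≡ n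
∑-notElem+length n []           _    _ = trans (+-identityʳ _) (∑-one n)
∑-notElem+length n (suc y ∷ V) dist ((_ , y<n) ∷ lV) = begin
  sumBelow n A + suc (length V)         ≡⟨ +-assoc (sumBelow n A) 1 (length V) ⟨
  sumBelow n A + 1 + length V           ≡⟨ cong (λ z → sumBelow n A + z + length V) (sym (∑-δ n y (λ _ → 1) y<n)) ⟩
  sumBelow n A + sumBelow n D + length V ≡⟨ cong (_+ length V) (sym (∑-+ n A D)) ⟩
  ∑[ j < n ] (A j + D j) + length V      ≡⟨ cong (_+ length V) (∑-cong n A+D≡C) ⟩
  sumBelow n C + length V               ≡⟨ ∑-notElem+length n V (proj₂ ds) lV ⟩
  n                                     ∎
  where
  open ≡-Reasoning
  ds = ∧-true {notElem (suc y) V} dist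
  A C D : ℕ → ℕ
  A j = 𝟙 (notElem (suc j) (suc y ∷ V))
  C j = 𝟙 (notElem (suc j) V)
  D j = 𝟙 (j ≡ᵇ y) * 1
  A+D≡C : ∀ j → j < n → A j + D j ≡ C j
  A+D≡C j _ with j ≡ᵇ y in eq
  ... | true  = cong 𝟙 (sym (trans (cong (λ z → notElem (suc z) V) (≡ᵇ-true⇒≡ j y eq)) (proj₁ ds)))
  ... | false = +-identityʳ _

∑-notElem : ∀ n V → distinct V ≡ true → Letters n V → ∑[ j < n ] 𝟙 (notElem (suc j) V) ≡ n ∸ length V
∑-notElem n V dV lV = trans (sym (m+n∸n≡m _ (length V))) (cong (_∸ length V) (∑-notElem+length n V dV lV))

count-freshFrom : ∀ n m V → distinct V ≡ true → Letters n V →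
  sumWords n m (𝟙 ∘ freshFrom V) ≡ falling (n ∸ length V) m
count-freshFrom n zero    V _  _  = refl
count-freshFrom n (suc m) V dV lV = begin
  ∑[ j < n ] sumWords n m (λ l → 𝟙 (notElem (suc j) V ∧ freshFrom (suc j ∷ V) l))
    ≡⟨ ∑-cong n split ⟩
  ∑[ j < n ] (𝟙 (notElem (suc j) V) * falling (n ∸ suc (length V)) m)
    ≡⟨ ∑-*ʳ n _ (λ j → 𝟙 (notElem (suc j) V)) ⟩
  ∑[ j < n ] 𝟙 (notElem (suc j) V) * falling (n ∸ suc (length V)) m
    ≡⟨ cong₂ _*_ (∑-notElem n V dV lV) (cong (λ z → falling z m) (sym (pred[m∸n]≡m∸[1+n] n (length V)))) ⟩
  falling (n ∸ length V) (suc m) ∎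
  where
  open ≡-Reasoning
  split : ∀ j → j < n → sumWords n m (λ l → 𝟙 (notElem (suc j) V ∧ freshFrom (suc j ∷ V) l))
                      ≡ 𝟙 (notElem (suc j) V) * falling (n ∸ suc (length V)) m
  split j j<n with notElem (suc j) V in fresh
  ... | false = sumWords-0 n m
  ... | true  = trans (count-freshFrom n m (suc j ∷ V) (trans (cong (_∧ distinct V) fresh) dV) ((s≤s z≤n , j<n) ∷ lV))
                      (sym (+-identityʳ _))

-- Pigeonhole, by counting.
injective-word-contains : ∀ n l x → Letters n l → length l ≡ n → distinct l ≡ true → InRange n x →
  disjoint l (x ∷ []) ≡ false
injective-word-contains n l x ll len dl (1≤x , x≤n) = begin
  disjoint l (x ∷ [])                   ≡⟨ cong (_∧ disjoint l (x ∷ [])) dl ⟨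
  distinct l ∧ disjoint l (x ∷ [])      ≡⟨ freshFrom≡distinct∧disjoint (x ∷ []) l ⟨
  freshFrom (x ∷ []) l                  ≡⟨ 𝟙≡0⇒false (sumWords≡0⇒≡0 n n _ none l ll len) ⟩
  false                                 ∎
  where
  open ≡-Reasoning
  none : sumWords n n (𝟙 ∘ freshFrom (x ∷ [])) ≡ 0
  none = trans (count-freshFrom n n (x ∷ []) refl ((1≤x , x≤n) ∷ []))
               (falling-≡0 (n ∸ 1) n (∸-monoʳ-< (s≤s z≤n) (≤-trans 1≤x x≤n)))

-- Counting words of distinct letters containing a given factor

isPrefixOf : List ℕ → List ℕ → Bool
isPrefixOf []       l        = true
isPrefixOf (w ∷ ws) []       = false
isPrefixOf (w ∷ ws) (x ∷ xs) = (w ≡ᵇ x) ∧ isPrefixOf ws xs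

isInfixOf : List ℕ → List ℕ → Bool
isInfixOf w []       = isPrefixOf w []
isInfixOf w (x ∷ xs) = isPrefixOf w (x ∷ xs) ∨ isInfixOf w xs

sameList : List ℕ → List ℕ → Bool
sameList []       []       = true
sameList []       (_ ∷ _)  = false
sameList (_ ∷ _)  []       = false
sameList (w ∷ ws) (x ∷ xs) = (w ≡ᵇ x) ∧ sameList ws xs

isSuffixOf : List ℕ → List ℕ → Bool
isSuffixOf w []       = sameList w []
isSuffixOf w (x ∷ xs) = sameList w (x ∷ xs) ∨ isSuffixOf w xs

sameList⇒isPrefixOf : ∀ u l → sameList u l ≡ true → isPrefixOf u l ≡ true
sameList⇒isPrefixOf []       []      e = refl
sameList⇒isPrefixOf (u ∷ us) (x ∷ l) e with ∧-true {u ≡ᵇ x} e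
... | ux , e′ rewrite ux = sameList⇒isPrefixOf us l e′

sameList≡isPrefixOf : ∀ u l → length l ≡ length u → sameList u l ≡ isPrefixOf u l
sameList≡isPrefixOf []       []      _ = refl
sameList≡isPrefixOf (u ∷ us) (x ∷ l) e = cong ((u ≡ᵇ x) ∧_) (sameList≡isPrefixOf us l (suc-injective e))

sameList-length : ∀ u l → length l ≢ length u → sameList u l ≡ false
sameList-length []       []      ne = ⊥-elim (ne refl)
sameList-length []       (x ∷ l) ne = refl
sameList-length (u ∷ us) []      ne = refl
sameList-length (u ∷ us) (x ∷ l) ne rewrite sameList-length us l (ne ∘ cong suc) = ∧-zeroʳ _

isPrefixOf-short : ∀ u l → length l < length u → isPrefixOf u l ≡ false
isPrefixOf-short (u ∷ us) []      _        = refl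
isPrefixOf-short (u ∷ us) (x ∷ l) (s≤s lt) rewrite isPrefixOf-short us l lt = ∧-zeroʳ _

isInfixOf-short : ∀ u l → length l < length u → isInfixOf u l ≡ false
isInfixOf-short (u ∷ us) []      _  = refl
isInfixOf-short u        (x ∷ l) lt rewrite isPrefixOf-short u (x ∷ l) lt = isInfixOf-short u l (<-trans (n<1+n _) lt)

isSuffixOf-short : ∀ u l → length l < length u → isSuffixOf u l ≡ false
isSuffixOf-short (u ∷ us) []      _  = refl
isSuffixOf-short u        (x ∷ l) lt rewrite sameList-length u (x ∷ l) (λ e → <-irrefl e lt) =
  isSuffixOf-short u l (<-trans (n<1+n _) lt)

isPrefixOf⇒disjoint : ∀ u V l → freshFrom V l ≡ true → isPrefixOf u l ≡ true → disjoint u V ≡ true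
isPrefixOf⇒disjoint []       V l        _ _ = refl
isPrefixOf⇒disjoint (u ∷ us) V (x ∷ xs) f p with ∧-true {notElem x V} f | ∧-true {u ≡ᵇ x} p
... | xV , f′ | ux , p′ =
  subst (λ z → notElem z V ∧ disjoint us V ≡ true) (sym (≡ᵇ-true⇒≡ u x ux))
    (trans (cong (_∧ disjoint us V) xV) (disjoint-∷ʳ⁻ us x V (isPrefixOf⇒disjoint us (x ∷ V) xs f′ p′)))

isInfixOf⇒disjoint : ∀ u V l → freshFrom V l ≡ true → isInfixOf u l ≡ true → disjoint u V ≡ true
isInfixOf⇒disjoint []      V l        _ _ = refl
isInfixOf⇒disjoint (_ ∷ _) V []       _ ()
isInfixOf⇒disjoint u       V (x ∷ xs) f i with ∨-true {isPrefixOf u (x ∷ xs)} i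
... | inj₁ p = isPrefixOf⇒disjoint u V (x ∷ xs) f p
... | inj₂ q = disjoint-∷ʳ⁻ u x V (isInfixOf⇒disjoint u (x ∷ V) xs (proj₂ (∧-true {notElem x V} f)) q)

isSuffixOf⇒disjoint : ∀ u V l → freshFrom V l ≡ true → isSuffixOf u l ≡ true → disjoint u V ≡ true
isSuffixOf⇒disjoint u V []       f e = isPrefixOf⇒disjoint u V [] f (sameList⇒isPrefixOf u [] e)
isSuffixOf⇒disjoint u V (x ∷ xs) f i with ∨-true {sameList u (x ∷ xs)} i
... | inj₁ p = isPrefixOf⇒disjoint u V (x ∷ xs) f (sameList⇒isPrefixOf u _ p)
... | inj₂ q = disjoint-∷ʳ⁻ u x V (isSuffixOf⇒disjoint u (x ∷ V) xs (proj₂ (∧-true {notElem x V} f)) q)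

count-prefix : ∀ n u m V → distinct u ≡ true → distinct V ≡ true → disjoint u V ≡ true → Letters n u → Letters n V →
  sumWords n (length u + m) (λ l → 𝟙 (freshFrom V l ∧ isPrefixOf u l)) ≡ falling (n ∸ (length u + length V)) m
count-prefix n [] m V _ dV _ _ lV =
  trans (sumWords-cong n m (λ l _ _ → cong 𝟙 (∧-identityʳ (freshFrom V l)))) (count-freshFrom n m V dV lV)
count-prefix n (suc u ∷ us) m V du dV dj ((_ , u<n) ∷ lus) lV = begin
  ∑[ j < n ] sumWords n (length us + m)
               (λ l → 𝟙 ((notElem (suc j) V ∧ freshFrom (suc j ∷ V) l) ∧ ((u ≡ᵇ j) ∧ isPrefixOf us l)))
    ≡⟨ ∑-cong n (λ j _ → onlyFirstLetterU j) ⟩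
  ∑[ j < n ] (𝟙 (u ≡ᵇ j) * X)
    ≡⟨ ∑-δ′ n u (λ _ → X) u<n ⟩
  X
    ≡⟨ count-prefix n us m (suc u ∷ V) (proj₂ dus) dV′ dj′ lus ((s≤s z≤n , u<n) ∷ lV) ⟩
  falling (n ∸ (length us + suc (length V))) m
    ≡⟨ cong (λ z → falling (n ∸ z) m) (+-suc (length us) (length V)) ⟩
  falling (n ∸ (suc (length us) + length V)) m ∎
  where
  open ≡-Reasoning
  dus = ∧-true {notElem (suc u) us} du
  djs = ∧-true {notElem (suc u) V} dj
  X = sumWords n (length us + m) (λ l → 𝟙 (freshFrom (suc u ∷ V) l ∧ isPrefixOf us l))
  dV′ : distinct (suc u ∷ V) ≡ true
  dV′ = trans (cong (_∧ distinct V) (proj₁ djs)) dV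
  dj′ : disjoint us (suc u ∷ V) ≡ true
  dj′ = trans (disjoint-∷ʳ us (suc u) V) (trans (cong (_∧ disjoint us V) (proj₁ dus)) (proj₂ djs))
  onlyFirstLetterU : ∀ j → sumWords n (length us + m)
      (λ l → 𝟙 ((notElem (suc j) V ∧ freshFrom (suc j ∷ V) l) ∧ ((u ≡ᵇ j) ∧ isPrefixOf us l))) ≡ 𝟙 (u ≡ᵇ j) * X
  onlyFirstLetterU j with u ≡ᵇ j in eq
  ... | false = sumWords-zero n (length us + m) (λ l _ _ → cong 𝟙 (∧-zeroʳ _))
  ... | true with refl ← ≡ᵇ-true⇒≡ u j eq rewrite proj₁ djs = sym (+-identityʳ X)

-- I tests for an occurrence of the factor suc w₀ ∷ ws and P for the rest of it; splitting on the first letter,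
-- either the factor starts there, or (as letters are distinct) the letter must avoid the factor.
module FirstLetter (n w₀ : ℕ) (ws : List ℕ) (P I : List ℕ → Bool)
  (I-∷ : ∀ x l → I (x ∷ l) ≡ ((suc w₀ ≡ᵇ x) ∧ P l) ∨ I l)
  (I⇒disjoint : ∀ V l → freshFrom V l ≡ true → I l ≡ true → disjoint (suc w₀ ∷ ws) V ≡ true) where

  w : List ℕ
  w = suc w₀ ∷ ws

  start-here : ∀ V l → notElem (suc w₀) V ≡ true →
    𝟙 ((notElem (suc w₀) V ∧ freshFrom (suc w₀ ∷ V) l) ∧ I (suc w₀ ∷ l)) ≡ 𝟙 (freshFrom (suc w₀ ∷ V) l ∧ P l)
  start-here V l fresh rewrite fresh | I-∷ (suc w₀) l | ≡ᵇ-refl w₀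
    with freshFrom (suc w₀ ∷ V) l in f | I l in i
  ... | false | _     = refl
  ... | true  | false = cong 𝟙 (∨-identityʳ (P l))
  ... | true  | true  = ⊥-elim (false≢true (trans (sym w₀-used) (I⇒disjoint (suc w₀ ∷ V) l f i)))
    where
    w₀-used : disjoint w (suc w₀ ∷ V) ≡ false
    w₀-used rewrite ≡ᵇ-refl w₀ = refl

  letter-outside-factor : ∀ V l j → (w₀ ≡ᵇ j) ≡ false → freshFrom (suc j ∷ V) l ∧ I l ≡ true → notElem (suc j) ws ≡ true
  letter-outside-factor V l j ne fi = trans (sym (notElem-∷-≢ (suc j) (suc w₀) ws (trans (≡ᵇ-sym j w₀) ne)))
    (proj₁ (∧-true (trans (sym (disjoint-∷ʳ w (suc j) V))
                          (I⇒disjoint (suc j ∷ V) l (proj₁ (∧-true fi)) (proj₂ (∧-true fi))))))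

  skip : ∀ V l j → (w₀ ≡ᵇ j) ≡ false →
    𝟙 ((notElem (suc j) V ∧ freshFrom (suc j ∷ V) l) ∧ I (suc j ∷ l))
      ≡ 𝟙 (notElem (suc j) (w ++ V)) * 𝟙 (freshFrom (suc j ∷ V) l ∧ I l)
  skip V l j ne rewrite I-∷ (suc j) l | ne | ≡ᵇ-sym j w₀ | ne | notElem-++ (suc j) ws V
                      | ∧-assoc (notElem (suc j) V) (freshFrom (suc j ∷ V) l) (I l)
    with freshFrom (suc j ∷ V) l ∧ I l in fi
  ... | false = trans (cong 𝟙 (∧-zeroʳ _)) (sym (*-zeroʳ (𝟙 (notElem (suc j) ws ∧ notElem (suc j) V))))
  ... | true  rewrite letter-outside-factor V l j ne fi = trans (cong 𝟙 (∧-identityʳ _)) (sym (*-identityʳ _))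

  sumWords-split : ∀ m V → w₀ < n → disjoint w V ≡ true →
    sumWords n (suc m) (λ l → 𝟙 (freshFrom V l ∧ I l)) ≡
      sumWords n m (λ l → 𝟙 (freshFrom (suc w₀ ∷ V) l ∧ P l))
      + ∑[ j < n ] (𝟙 (notElem (suc j) (w ++ V)) * sumWords n m (λ l → 𝟙 (freshFrom (suc j ∷ V) l ∧ I l)))
  sumWords-split m V w₀<n dj = begin
    ∑[ j < n ] sumWords n m (λ l → 𝟙 (freshFrom V (suc j ∷ l) ∧ I (suc j ∷ l)))
      ≡⟨ ∑-cong n (λ j _ → byFirstLetter j) ⟩
    ∑[ j < n ] (𝟙 (w₀ ≡ᵇ j) * Pc + R j)
      ≡⟨ ∑-+ n _ R ⟩
    ∑[ j < n ] (𝟙 (w₀ ≡ᵇ j) * Pc) + sumBelow n R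
      ≡⟨ cong (_+ sumBelow n R) (∑-δ′ n w₀ (λ _ → Pc) w₀<n) ⟩
    Pc + sumBelow n R ∎
    where
    open ≡-Reasoning
    Pc : ℕ
    Pc = sumWords n m (λ l → 𝟙 (freshFrom (suc w₀ ∷ V) l ∧ P l))
    R : ℕ → ℕ
    R j = 𝟙 (notElem (suc j) (w ++ V)) * sumWords n m (λ l → 𝟙 (freshFrom (suc j ∷ V) l ∧ I l))
    byFirstLetter : ∀ j → sumWords n m (λ l → 𝟙 (freshFrom V (suc j ∷ l) ∧ I (suc j ∷ l))) ≡ 𝟙 (w₀ ≡ᵇ j) * Pc + R j
    byFirstLetter j with w₀ ≡ᵇ j in eq
    ... | true with refl ← ≡ᵇ-true⇒≡ w₀ j eq rewrite ≡ᵇ-refl w₀ =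
      trans (sumWords-cong n m (λ l _ _ → start-here V l (proj₁ (∧-true dj))))
            (sym (trans (+-identityʳ _) (+-identityʳ Pc)))
    ... | false = trans (sumWords-cong n m (λ l _ _ → skip V l j eq))
                        (sumWords-*ˡ n m (𝟙 (notElem (suc j) (w ++ V))) _)

∑-over-fresh-letters : ∀ n U (f : ℕ → ℕ) C → distinct U ≡ true → Letters n U →
  (∀ j → j < n → notElem (suc j) U ≡ true → f j ≡ C) →
  ∑[ j < n ] (𝟙 (notElem (suc j) U) * f j) ≡ (n ∸ length U) * C
∑-over-fresh-letters n U f C dU lU h = begin
  ∑[ j < n ] (𝟙 (notElem (suc j) U) * f j)  ≡⟨ ∑-cong n onFresh ⟩
  ∑[ j < n ] (𝟙 (notElem (suc j) U) * C)    ≡⟨ ∑-*ʳ n C _ ⟩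
  ∑[ j < n ] 𝟙 (notElem (suc j) U) * C      ≡⟨ cong (_* C) (∑-notElem n U dU lU) ⟩
  (n ∸ length U) * C                         ∎
  where
  open ≡-Reasoning
  onFresh : ∀ j → j < n → 𝟙 (notElem (suc j) U) * f j ≡ 𝟙 (notElem (suc j) U) * C
  onFresh j j<n = 𝟙-*-cong (notElem (suc j) U) (h j j<n)

module Factor (n w₀ : ℕ) (ws : List ℕ) (w₀<n : w₀ < n) (lws : Letters n ws)
  (dw : distinct (suc w₀ ∷ ws) ≡ true) where

  w : List ℕ
  w = suc w₀ ∷ ws

  private
    lw : Letters n w
    lw = (s≤s z≤n , w₀<n) ∷ lws

    dws = ∧-true {notElem (suc w₀) ws} dw

    V-∷-w₀ : ∀ {V} → distinct V ≡ true → disjoint w V ≡ true →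
      distinct (suc w₀ ∷ V) ≡ true × disjoint ws (suc w₀ ∷ V) ≡ true
    V-∷-w₀ {V} dV dj with ∧-true {notElem (suc w₀) V} dj
    ... | w₀V , djs = trans (cong (_∧ distinct V) w₀V) dV
                    , trans (disjoint-∷ʳ ws (suc w₀) V) (trans (cong (_∧ disjoint ws V) (proj₁ dws)) djs)

    V-∷-fresh : ∀ {x V} → distinct V ≡ true → disjoint w V ≡ true → notElem x (w ++ V) ≡ true →
      distinct (x ∷ V) ≡ true × disjoint w (x ∷ V) ≡ true
    V-∷-fresh {x} {V} dV dj fresh with ∧-true {notElem x w} (trans (sym (notElem-++ x w V)) fresh)
    ... | xw , xV = trans (cong (_∧ distinct V) xV) dV
                  , trans (disjoint-∷ʳ w x V) (trans (cong (_∧ disjoint w V) xw) dj)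

    count-prefix-ws : ∀ m V → distinct V ≡ true → disjoint w V ≡ true → Letters n V →
      sumWords n (length ws + m) (λ l → 𝟙 (freshFrom (suc w₀ ∷ V) l ∧ isPrefixOf ws l))
        ≡ falling (n ∸ (length w + length V)) m
    count-prefix-ws m V dV dj lV with V-∷-w₀ dV dj
    ... | dV′ , dj′ = trans (count-prefix n ws m (suc w₀ ∷ V) (proj₂ dws) dV′ dj′ lws ((s≤s z≤n , w₀<n) ∷ lV))
                            (cong (λ z → falling (n ∸ z) m) (+-suc (length ws) (length V)))

    ∑-continue : ∀ V (f : ℕ → ℕ) C → distinct V ≡ true → disjoint w V ≡ true → Letters n V →
      (∀ j → j < n → distinct (suc j ∷ V) ≡ true → disjoint w (suc j ∷ V) ≡ true → Letters n (suc j ∷ V) → f j ≡ C) →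
      ∑[ j < n ] (𝟙 (notElem (suc j) (w ++ V)) * f j) ≡ (n ∸ (length w + length V)) * C
    ∑-continue V f C dV dj lV h =
      trans (∑-over-fresh-letters n (w ++ V) f C (distinct-++ w V dw dV dj) (++⁺ lw lV)
               (λ j j<n fresh → let d , d′ = V-∷-fresh dV dj fresh in h j j<n d d′ ((s≤s z≤n , j<n) ∷ lV)))
            (cong (λ z → (n ∸ z) * C) (length-++ w))

    ∑-too-short : ∀ V (J : List ℕ → Bool) → (∀ l → length l < length w → J l ≡ false) →
      ∑[ j < n ] (𝟙 (notElem (suc j) (w ++ V)) * sumWords n (length ws + 0) (λ l → 𝟙 (freshFrom (suc j ∷ V) l ∧ J l))) ≡ 0
    ∑-too-short V J short = ∑-zero n (λ j → trans (cong (𝟙 (notElem (suc j) (w ++ V)) *_)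
      (sumWords-zero n _ (λ l _ len → cong 𝟙 (trans (cong (freshFrom (suc j ∷ V) l ∧_)
        (short l (s≤s (≤-reflexive (trans len (+-identityʳ _)))))) (∧-zeroʳ _)))))
      (*-zeroʳ (𝟙 (notElem (suc j) (w ++ V)))))

    ∸-suc-length : ∀ (V : List ℕ) → n ∸ (length w + suc (length V)) ≡ pred (n ∸ (length w + length V))
    ∸-suc-length V = trans (cong (n ∸_) (+-suc (length w) (length V))) (sym (pred[m∸n]≡m∸[1+n] n (length w + length V)))

  module Infix  = FirstLetter n w₀ ws (isPrefixOf ws) (isInfixOf w) (λ _ _ → refl) (λ V l f i → isInfixOf⇒disjoint w V l f i)
  module Suffix = FirstLetter n w₀ ws (sameList ws) (isSuffixOf w) (λ _ _ → refl) (λ V l f i → isSuffixOf⇒disjoint w V l f i)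

  count-infix : ∀ k V → distinct V ≡ true → disjoint w V ≡ true → Letters n V →
    sumWords n (length w + k) (λ l → 𝟙 (freshFrom V l ∧ isInfixOf w l)) ≡ suc k * falling (n ∸ (length w + length V)) k
  count-infix zero V dV dj lV = trans (Infix.sumWords-split (length ws + 0) V w₀<n dj)
    (cong₂ _+_ (count-prefix-ws 0 V dV dj lV) (∑-too-short V (isInfixOf w) (isInfixOf-short w)))
  count-infix (suc k) V dV dj lV = begin
    sumWords n (suc (length ws + suc k)) (λ l → 𝟙 (freshFrom V l ∧ isInfixOf w l))
      ≡⟨ Infix.sumWords-split (length ws + suc k) V w₀<n dj ⟩
    sumWords n (length ws + suc k) (λ l → 𝟙 (freshFrom (suc w₀ ∷ V) l ∧ isPrefixOf ws l))
      + ∑[ j < n ] (𝟙 (notElem (suc j) (w ++ V))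
                      * sumWords n (length ws + suc k) (λ l → 𝟙 (freshFrom (suc j ∷ V) l ∧ isInfixOf w l)))
      ≡⟨ cong₂ _+_ (count-prefix-ws (suc k) V dV dj lV)
                   (∑-continue V _ (suc k * falling (n ∸ (length w + suc (length V))) k) dV dj lV occurrenceLater) ⟩
    falling K (suc k) + K * (suc k * falling (n ∸ (length w + suc (length V))) k)
      ≡⟨ cong (λ z → falling K (suc k) + K * (suc k * falling z k)) (∸-suc-length V) ⟩
    K * falling (pred K) k + K * (suc k * falling (pred K) k)
      ≡⟨ solve 3 (λ K F k → K :* F :+ K :* ((con 1 :+ k) :* F) := (con 2 :+ k) :* (K :* F)) refl K (falling (pred K) k) k ⟩
    suc (suc k) * falling K (suc k) ∎
    where
    open ≡-Reasoning
    K = n ∸ (length w + length V)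
    occurrenceLater : ∀ j → j < n → distinct (suc j ∷ V) ≡ true → disjoint w (suc j ∷ V) ≡ true → Letters n (suc j ∷ V) →
      sumWords n (length ws + suc k) (λ l → 𝟙 (freshFrom (suc j ∷ V) l ∧ isInfixOf w l))
        ≡ suc k * falling (n ∸ (length w + suc (length V))) k
    occurrenceLater j _ dV′ dj′ lV′ =
      trans (cong (λ z → sumWords n z (λ l → 𝟙 (freshFrom (suc j ∷ V) l ∧ isInfixOf w l))) (+-suc (length ws) k))
            (count-infix k (suc j ∷ V) dV′ dj′ lV′)

  count-suffix : ∀ k V → distinct V ≡ true → disjoint w V ≡ true → Letters n V →
    sumWords n (length w + k) (λ l → 𝟙 (freshFrom V l ∧ isSuffixOf w l)) ≡ falling (n ∸ (length w + length V)) k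
  count-suffix zero V dV dj lV = trans (Suffix.sumWords-split (length ws + 0) V w₀<n dj)
    (cong₂ _+_ (trans (sumWords-cong n _ (λ l _ len → cong (λ b → 𝟙 (freshFrom (suc w₀ ∷ V) l ∧ b))
                        (sameList≡isPrefixOf ws l (trans len (+-identityʳ _)))))
                      (count-prefix-ws 0 V dV dj lV))
               (∑-too-short V (isSuffixOf w) (isSuffixOf-short w)))
  count-suffix (suc k) V dV dj lV = begin
    sumWords n (suc (length ws + suc k)) (λ l → 𝟙 (freshFrom V l ∧ isSuffixOf w l))
      ≡⟨ Suffix.sumWords-split (length ws + suc k) V w₀<n dj ⟩
    sumWords n (length ws + suc k) (λ l → 𝟙 (freshFrom (suc w₀ ∷ V) l ∧ sameList ws l))
      + ∑[ j < n ] (𝟙 (notElem (suc j) (w ++ V))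
                      * sumWords n (length ws + suc k) (λ l → 𝟙 (freshFrom (suc j ∷ V) l ∧ isSuffixOf w l)))
      ≡⟨ cong₂ _+_ endsTooEarly
                   (∑-continue V _ (falling (n ∸ (length w + suc (length V))) k) dV dj lV occurrenceLater) ⟩
    0 + K * falling (n ∸ (length w + suc (length V))) k
      ≡⟨ cong (λ z → K * falling z k) (∸-suc-length V) ⟩
    falling K (suc k) ∎
    where
    open ≡-Reasoning
    K = n ∸ (length w + length V)
    endsTooEarly : sumWords n (length ws + suc k) (λ l → 𝟙 (freshFrom (suc w₀ ∷ V) l ∧ sameList ws l)) ≡ 0
    endsTooEarly = sumWords-zero n _ (λ l _ len → cong 𝟙 (trans (cong (freshFrom (suc w₀ ∷ V) l ∧_)
      (sameList-length ws l (m+1+n≢m (length ws) ∘ trans (sym len)))) (∧-zeroʳ _)))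
    occurrenceLater : ∀ j → j < n → distinct (suc j ∷ V) ≡ true → disjoint w (suc j ∷ V) ≡ true → Letters n (suc j ∷ V) →
      sumWords n (length ws + suc k) (λ l → 𝟙 (freshFrom (suc j ∷ V) l ∧ isSuffixOf w l))
        ≡ falling (n ∸ (length w + suc (length V))) k
    occurrenceLater j _ dV′ dj′ lV′ =
      trans (cong (λ z → sumWords n z (λ l → 𝟙 (freshFrom (suc j ∷ V) l ∧ isSuffixOf w l))) (+-suc (length ws) k))
            (count-suffix k (suc j ∷ V) dV′ dj′ lV′)

-- Runs and their sorting

StartsAscending : List ℕ → Set
StartsAscending []          = ⊥
StartsAscending (x ∷ [])    = ⊤
StartsAscending (x ∷ y ∷ _) = x < y

consRun-wellFormed : ∀ x xs rs → All (λ r → StartsAscending r × firstEntry r ∈ xs) rs →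
  All (λ r → StartsAscending r × firstEntry r ∈ x ∷ xs) (consRun x rs)
consRun-wellFormed x xs []             _              = (tt , here refl) ∷ []
consRun-wellFormed x xs ((y ∷ r) ∷ rs) ((asc , y∈) ∷ a) with x <ᵇ y in x<y
... | true  = (<ᵇ⇒<′ x<y , here refl) ∷ All.map (λ (asc′ , m) → asc′ , there m) a
... | false = (tt , here refl) ∷ (asc , there y∈) ∷ All.map (λ (asc′ , m) → asc′ , there m) a

runs-wellFormed : ∀ l → All (λ r → StartsAscending r × firstEntry r ∈ l) (runs l)
runs-wellFormed []       = []
runs-wellFormed (x ∷ xs) = consRun-wellFormed x xs (runs xs) (runs-wellFormed xs)

DistinctHeads : List (List ℕ) → Set
DistinctHeads []       = ⊤
DistinctHeads (r ∷ rs) = All (λ s → firstEntry s ≢ firstEntry r) rs × DistinctHeads rs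

consRun-distinctHeads : ∀ x xs rs → notElem x xs ≡ true → DistinctHeads rs → All (λ r → firstEntry r ∈ xs) rs →
  DistinctHeads (consRun x rs)
consRun-distinctHeads x xs []             _  _       _        = [] , tt
consRun-distinctHeads x xs ([] ∷ rs)      ne (_ , h) (_ ∷ ms) = All.map (λ m e → notElem⇒∉ ne (subst (_∈ xs) e m)) ms , h
consRun-distinctHeads x xs ((y ∷ r) ∷ rs) ne (a , h) (m ∷ ms) with x <ᵇ y
... | true  = All.map (λ m′ e → notElem⇒∉ ne (subst (_∈ xs) e m′)) ms , h
... | false = All.map (λ m′ e → notElem⇒∉ ne (subst (_∈ xs) e m′)) (m ∷ ms) , a , h

runs-distinctHeads : ∀ l → distinct l ≡ true → DistinctHeads (runs l)
runs-distinctHeads []       _ = tt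
runs-distinctHeads (x ∷ xs) d with ∧-true {notElem x xs} d
... | x∉xs , dxs = consRun-distinctHeads x xs (runs xs) x∉xs (runs-distinctHeads xs dxs) (All.map proj₂ (runs-wellFormed xs))

SortedByHead : List (List ℕ) → Set
SortedByHead []       = ⊤
SortedByHead (r ∷ ss) = All (λ s → firstEntry r < firstEntry s) ss × SortedByHead ss

insertRun⁺ : ∀ {P : List ℕ → Set} r ss → P r → All P ss → All P (insertRun r ss)
insertRun⁺ r []       pr _          = pr ∷ []
insertRun⁺ r (s ∷ ss) pr (ps ∷ pss) with firstEntry r <ᵇ firstEntry s
... | true  = pr ∷ ps ∷ pss
... | false = ps ∷ insertRun⁺ r ss pr pss

sortRuns⁺ : ∀ {P : List ℕ → Set} rs → All P rs → All P (sortRuns rs)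
sortRuns⁺ []       _          = []
sortRuns⁺ (r ∷ rs) (pr ∷ prs) = insertRun⁺ r (sortRuns rs) pr (sortRuns⁺ rs prs)

insertRun-sorted : ∀ r ss → SortedByHead ss → All (λ s → firstEntry s ≢ firstEntry r) ss → SortedByHead (insertRun r ss)
insertRun-sorted r []       _         _          = [] , tt
insertRun-sorted r (s ∷ ss) (ls , ss↑) (ne ∷ nes) with firstEntry r <ᵇ firstEntry s in e
... | true  = let r<s = <ᵇ⇒<′ e in (r<s ∷ All.map (<-trans r<s) ls) , ls , ss↑
... | false = insertRun⁺ r ss (≤∧≢⇒< (≮ᵇ⇒≥ e) ne) ls , insertRun-sorted r ss ss↑ nes

sortRuns-sorted : ∀ rs → DistinctHeads rs → SortedByHead (sortRuns rs)
sortRuns-sorted []       _       = tt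
sortRuns-sorted (r ∷ rs) (a , h) = insertRun-sorted r (sortRuns rs) (sortRuns-sorted rs h) (sortRuns⁺ rs a)

∈-insertRun : ∀ r ss {t} → t ∈ r ∷ ss → t ∈ insertRun r ss
∈-insertRun r []       m = m
∈-insertRun r (s ∷ ss) m with firstEntry r <ᵇ firstEntry s
... | true = m
∈-insertRun r (s ∷ ss) (here e)          | false = there (∈-insertRun r ss (here e))
∈-insertRun r (s ∷ ss) (there (here e))  | false = here e
∈-insertRun r (s ∷ ss) (there (there m)) | false = there (∈-insertRun r ss (there m))

∈-sortRuns : ∀ rs {t} → t ∈ rs → t ∈ sortRuns rs
∈-sortRuns (r ∷ rs) (here e)  = ∈-insertRun r (sortRuns rs) (here e)
∈-sortRuns (r ∷ rs) (there m) = ∈-insertRun r (sortRuns rs) (there (∈-sortRuns rs m))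

runs-∷ : ∀ y r → ∃₂ λ r′ rs′ → runs (y ∷ r) ≡ (y ∷ r′) ∷ rs′
runs-∷ y r with runs r
... | []             = [] , [] , refl
... | [] ∷ rs        = [] , rs , refl
... | (z ∷ t) ∷ rs with y <ᵇ z
...   | true  = z ∷ t , rs , refl
...   | false = [] , (z ∷ t) ∷ rs , refl

consRun-keeps : ∀ x rs y t → (y ∷ t) ∈ rs → (x <ᵇ y) ≡ false → (y ∷ t) ∈ consRun x rs
consRun-keeps x ([] ∷ rs)      y t (there m) _ = there m
consRun-keeps x ((z ∷ r) ∷ rs) y t m ne with x <ᵇ z in e
consRun-keeps x ((z ∷ r) ∷ rs) y t (here refl) ne | true = ⊥-elim (false≢true (trans (sym ne) e))
consRun-keeps x ((z ∷ r) ∷ rs) y t (there m)   ne | true = there m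
consRun-keeps x ((z ∷ r) ∷ rs) y t m           ne | false = there m

consRun-keepsLater : ∀ x r rs {s} → s ∈ rs → s ∈ consRun x (r ∷ rs)
consRun-keepsLater x []      rs m = there m
consRun-keepsLater x (z ∷ r) rs m with x <ᵇ z
... | true  = there m
... | false = there (there m)

runOfOne-++ : ∀ p ys t → All (1 ≤_) p → (1 ∷ t) ∈ runs ys → (1 ∷ t) ∈ runs (p ++ ys)
runOfOne-++ []           ys t _        m = m
runOfOne-++ (suc x ∷ p) ys t (_ ∷ ps) m = consRun-keeps (suc x) (runs (p ++ ys)) 1 t (runOfOne-++ p ys t ps m) refl

two-headsRun : ∀ l → All (1 ≤_) l → 2 ∈ l → isInfixOf (1 ∷ 2 ∷ []) l ≡ false → ∃ λ t → (2 ∷ t) ∈ runs l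
two-headsRun (x ∷ xs) _ (here refl) _ with runs-∷ 2 xs
... | r′ , rs′ , eq = r′ , subst ((2 ∷ r′) ∈_) (sym eq) (here refl)
two-headsRun (x ∷ xs) (_ ∷ ps) (there m) no12 with ∨-false {isPrefixOf (1 ∷ 2 ∷ []) (x ∷ xs)} no12
... | not12here , no12′ with two-headsRun xs ps m no12′
two-headsRun (suc (suc x) ∷ xs) _ (there m) _ | _ , _ | t , m2 =
  t , consRun-keeps (suc (suc x)) (runs xs) 2 t m2 refl
two-headsRun (suc zero ∷ y ∷ xs) _ (there m) _ | not12here , _ | t , m2 with runs-∷ y xs
... | r′ , rs′ , eq =
  t , subst (λ rs → (2 ∷ t) ∈ consRun 1 rs) (sym eq) (consRun-keepsLater 1 (y ∷ r′) rs′ (notFirst (subst ((2 ∷ t) ∈_) eq m2)))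
  where
  y≢2 : y ≢ 2
  y≢2 refl = false≢true (sym not12here)
  notFirst : (2 ∷ t) ∈ (y ∷ r′) ∷ rs′ → (2 ∷ t) ∈ rs′
  notFirst (here refl) = ⊥-elim (y≢2 refl)
  notFirst (there m′)  = m′

-- When runsort has a descent at position 2

afterOne : List ℕ → List ℕ
afterOne []       = []
afterOne (x ∷ xs) = if x ≡ᵇ 1 then xs else afterOne xs

endsRunAbove2 : List ℕ → Bool
endsRunAbove2 []          = false
endsRunAbove2 (b ∷ [])    = 2 <ᵇ b
endsRunAbove2 (b ∷ c ∷ _) = (2 <ᵇ b) ∧ (c <ᵇ b)

RunAbove1 : List ℕ → Set
RunAbove1 r = StartsAscending r × 1 < firstEntry r

sorted-runOfOne-first : ∀ S r₁ → SortedByHead S → All (λ r → StartsAscending r × 1 ≤ firstEntry r) S → (1 ∷ r₁) ∈ S →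
  ∃ λ S′ → S ≡ (1 ∷ r₁) ∷ S′ × SortedByHead S′ × All RunAbove1 S′
sorted-runOfOne-first (_ ∷ S′) r₁ (ls , S′↑) (_ ∷ as) (here refl) = S′ , refl , S′↑ , zipAbove1 S′ ls as
  where
  zipAbove1 : ∀ S′ → All (λ s → 1 < firstEntry s) S′ → All (λ r → StartsAscending r × 1 ≤ firstEntry r) S′ →
    All RunAbove1 S′
  zipAbove1 []       _        _              = []
  zipAbove1 (s ∷ S′) (a ∷ as) ((asc , _) ∷ bs) = (asc , a) ∷ zipAbove1 S′ as bs
sorted-runOfOne-first (_ ∷ S′) r₁ (ls , _) ((_ , 1≤) ∷ _) (there m) = ⊥-elim (≤⇒≯ 1≤ (All.lookup ls m))

no-descent-after-1 : ∀ S′ → SortedByHead S′ → All RunAbove1 S′ → descentAt2 (1 ∷ concat S′) ≡ false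
no-descent-after-1 []                            _            _                  = refl
no-descent-after-1 ([] ∷ _)                      _            ((() , _) ∷ _)
no-descent-after-1 ((u ∷ []) ∷ ([] ∷ _))         _            (_ ∷ (() , _) ∷ _)
no-descent-after-1 ((u ∷ []) ∷ [])               _            _                  = refl
no-descent-after-1 ((u ∷ []) ∷ ((w ∷ r) ∷ S′))   ((u<w ∷ _) , _) _               = ≥⇒≮ᵇ (<⇒≤ u<w)
no-descent-after-1 ((u ∷ v ∷ r) ∷ S′)            _            ((u<v , _) ∷ _)    = ≥⇒≮ᵇ (<⇒≤ u<v)

-- After the run 1 y, the next letter of runsort is the smallest head above 1: it is 2 whenever y ≠ 2.
descent-after-1y : ∀ S′ y → SortedByHead S′ → All RunAbove1 S′ → 2 ≤ y →
  ((2 <ᵇ y) ≡ true → ∃ λ t → (2 ∷ t) ∈ S′) → descentAt2 (1 ∷ y ∷ concat S′) ≡ (2 <ᵇ y)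
descent-after-1y S′ 0 _ _ () _
descent-after-1y S′ 1 _ _ (s≤s ()) _
descent-after-1y []            2 _ _ _ _ = refl
descent-after-1y ([] ∷ _)      2 _ ((() , _) ∷ _) _ _
descent-after-1y ((u ∷ r) ∷ _) 2 _ ((_ , 1<u) ∷ _) _ _ = ≥⇒≮ᵇ 1<u
descent-after-1y S′ (suc (suc (suc y))) S′↑ above _ two = twoFollows S′ S′↑ above (two refl)
  where
  twoFollows : ∀ S′ → SortedByHead S′ → All RunAbove1 S′ → (∃ λ t → (2 ∷ t) ∈ S′) →
    descentAt2 (1 ∷ suc (suc (suc y)) ∷ concat S′) ≡ true
  twoFollows ([] ∷ S′)      _        ((() , _) ∷ _) _
  twoFollows ((u ∷ r) ∷ S′) _        _ (t , here refl) = refl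
  twoFollows ((u ∷ r) ∷ S′) (ls , _) _ (t , there m) = <⇒<ᵇ′ (<-trans (All.lookup ls m) (s≤s (s≤s (s≤s z≤n))))

notElem⇒¬isInfixOf : ∀ a w ys → notElem a ys ≡ true → isInfixOf (a ∷ w) ys ≡ false
notElem⇒¬isInfixOf a w []       _  = refl
notElem⇒¬isInfixOf a w (y ∷ ys) ne with a ≡ᵇ y
... | true  = ⊥-elim (false≢true ne)
... | false = notElem⇒¬isInfixOf a w ys ne

notElem⇒¬isSuffixOf : ∀ a w ys → notElem a ys ≡ true → isSuffixOf (a ∷ w) ys ≡ false
notElem⇒¬isSuffixOf a w []       _  = refl
notElem⇒¬isSuffixOf a w (y ∷ ys) ne with a ≡ᵇ y
... | true  = ⊥-elim (false≢true ne)
... | false = notElem⇒¬isSuffixOf a w ys ne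

notElem-[1] : ∀ x → notElem x (1 ∷ []) ≡ true → (x ≡ᵇ 1) ≡ false
notElem-[1] x e with x ≡ᵇ 1
... | true  = ⊥-elim (false≢true e)
... | false = refl

no-12-factor : ∀ p ys → disjoint p (1 ∷ []) ≡ true → notElem 1 ys ≡ true → isPrefixOf (2 ∷ []) ys ≡ false →
  isInfixOf (1 ∷ 2 ∷ []) (p ++ 1 ∷ ys) ≡ false
no-12-factor []      ys _  ne not2 rewrite not2 = notElem⇒¬isInfixOf 1 (2 ∷ []) ys ne
no-12-factor (x ∷ p) ys dj ne not2 with ∧-true {notElem x (1 ∷ [])} dj
... | x≢1 , dj′ rewrite ≡ᵇ-sym 1 x | notElem-[1] x x≢1 = no-12-factor p ys dj′ ne not2

afterOne-++ : ∀ p xs → disjoint p (1 ∷ []) ≡ true → afterOne (p ++ 1 ∷ xs) ≡ xs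
afterOne-++ []      xs _  = refl
afterOne-++ (x ∷ p) xs dj with ∧-true {notElem x (1 ∷ [])} dj
... | x≢1 , dj′ rewrite notElem-[1] x x≢1 = afterOne-++ p xs dj′

distinct⇒≢ : ∀ y z zs → distinct (y ∷ z ∷ zs) ≡ true → y ≢ z
distinct⇒≢ y .y zs d refl rewrite ≡ᵇ-refl y = false≢true d

module RunOfOne (p xs : List ℕ) (pos : All (1 ≤_) (p ++ 1 ∷ xs)) (dist : distinct (p ++ 1 ∷ xs) ≡ true)
  (two∈ : 2 ∈ p ++ 1 ∷ xs) (p∌1 : disjoint p (1 ∷ []) ≡ true) where

  l : List ℕ
  l = p ++ 1 ∷ xs

  1∉xs : notElem 1 xs ≡ true
  1∉xs = proj₁ (∧-true (distinct-++⁻ʳ p (1 ∷ xs) dist))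

  via-runOfOne : ∀ r₁ b → (1 ∷ r₁) ∈ runs (1 ∷ xs) →
    (∀ S′ → SortedByHead S′ → All RunAbove1 S′ → (∀ t → (2 ∷ t) ∈ runs l → (2 ∷ t) ∈ S′) →
      descentAt2 (1 ∷ r₁ ++ concat S′) ≡ b) →
    descentAt2 (runsort l) ≡ b
  via-runOfOne r₁ b r₁∈ k
    with sorted-runOfOne-first (sortRuns (runs l)) r₁ (sortRuns-sorted (runs l) (runs-distinctHeads l dist))
           (sortRuns⁺ (runs l) (All.map (λ (asc , m) → asc , All.lookup pos m) (runs-wellFormed l)))
           (∈-sortRuns (runs l) (runOfOne-++ p (1 ∷ xs) r₁ (++⁻ˡ p pos) r₁∈))
  ... | S′ , eq , S′↑ , above =
    trans (cong (descentAt2 ∘ concat) eq) (k S′ S′↑ above (λ t m → twoIn t (∈-sortRuns (runs l) m)))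
    where
    twoIn : ∀ t → (2 ∷ t) ∈ sortRuns (runs l) → (2 ∷ t) ∈ S′
    twoIn t m with subst ((2 ∷ t) ∈_) eq m
    ... | there m′ = m′

  two-headsRun-after : ∀ y rest → xs ≡ y ∷ rest → ∀ S′ → (∀ t → (2 ∷ t) ∈ runs l → (2 ∷ t) ∈ S′) →
    (2 <ᵇ y) ≡ true → ∃ λ t → (2 ∷ t) ∈ S′
  two-headsRun-after (suc (suc (suc y))) rest refl S′ runs⊆ _
    with two-headsRun l pos two∈ (no-12-factor p (suc (suc (suc y)) ∷ rest) p∌1 1∉xs refl)
  ... | t , m = t , runs⊆ t m

descentAt2-runsort-++ : ∀ p xs → All (1 ≤_) (p ++ 1 ∷ xs) → distinct (p ++ 1 ∷ xs) ≡ true → 2 ∈ p ++ 1 ∷ xs →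
  disjoint p (1 ∷ []) ≡ true → descentAt2 (runsort (p ++ 1 ∷ xs)) ≡ endsRunAbove2 xs
descentAt2-runsort-++ p [] pos dist two∈ p∌1 =
  via-runOfOne [] false (here refl) (λ S′ S′↑ above _ → no-descent-after-1 S′ S′↑ above)
  where open RunOfOne p [] pos dist two∈ p∌1
descentAt2-runsort-++ p (0 ∷ _) pos _ _ _ with All.lookup (++⁻ʳ p pos) (there (here refl))
... | ()
descentAt2-runsort-++ p (1 ∷ rest) pos dist two∈ p∌1 = ⊥-elim (false≢true 1∉xs)
  where open RunOfOne p (1 ∷ rest) pos dist two∈ p∌1
descentAt2-runsort-++ p (suc (suc y) ∷ []) pos dist two∈ p∌1 =
  via-runOfOne (suc (suc y) ∷ []) _ (here refl) (λ S′ S′↑ above runs⊆ →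
    descent-after-1y S′ (suc (suc y)) S′↑ above (s≤s (s≤s z≤n)) (two-headsRun-after (suc (suc y)) [] refl S′ runs⊆))
  where open RunOfOne p (suc (suc y) ∷ []) pos dist two∈ p∌1
descentAt2-runsort-++ p (suc (suc y) ∷ z ∷ zs) pos dist two∈ p∌1 with runs-∷ z zs | suc (suc y) <ᵇ z in y<z?
... | r″ , rs″ , eqz | true = via-runOfOne (suc (suc y) ∷ z ∷ r″) _ r₁∈
  (λ _ _ _ _ → trans z≮y (sym (trans (cong ((2 <ᵇ suc (suc y)) ∧_) z≮y) (∧-zeroʳ _))))
  where
  open RunOfOne p (suc (suc y) ∷ z ∷ zs) pos dist two∈ p∌1
  z≮y : (z <ᵇ suc (suc y)) ≡ false
  z≮y = ≥⇒≮ᵇ (<⇒≤ (<ᵇ⇒<′ {suc (suc y)} {z} y<z?))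
  r₁∈ : (1 ∷ suc (suc y) ∷ z ∷ r″) ∈ runs (1 ∷ suc (suc y) ∷ z ∷ zs)
  r₁∈ rewrite eqz | y<z? = here refl
... | r″ , rs″ , eqz | false = via-runOfOne (suc (suc y) ∷ []) _ r₁∈ (λ S′ S′↑ above runs⊆ →
    trans (descent-after-1y S′ (suc (suc y)) S′↑ above (s≤s (s≤s z≤n))
                            (two-headsRun-after (suc (suc y)) (z ∷ zs) refl S′ runs⊆))
          (sym (trans (cong ((2 <ᵇ suc (suc y)) ∧_) z<y) (∧-identityʳ _))))
  where
  open RunOfOne p (suc (suc y) ∷ z ∷ zs) pos dist two∈ p∌1
  r₁∈ : (1 ∷ suc (suc y) ∷ []) ∈ runs (1 ∷ suc (suc y) ∷ z ∷ zs)
  r₁∈ rewrite eqz | y<z? = here refl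
  z<y : (z <ᵇ suc (suc y)) ≡ true
  z<y = <⇒<ᵇ′ (≤∧≢⇒< (≮ᵇ⇒≥ {suc (suc y)} {z} y<z?) (λ z≡y → distinct⇒≢ (suc (suc y)) z zs
          (proj₂ (∧-true {notElem 1 (suc (suc y) ∷ z ∷ zs)} (distinct-++⁻ʳ p (1 ∷ suc (suc y) ∷ z ∷ zs) dist))) (sym z≡y)))

-- The descent as occurrences of the factors 1y at the end or 1yz with 2 ≤ z < y anywhere, where y = suc j, z = suc i

patternTerm : ℕ → (ℕ → Bool) → (ℕ → ℕ → Bool) → ℕ → ℕ
patternTerm n S I j = 𝟙 (2 <ᵇ suc j) * (𝟙 (S j) + ∑[ i < n ] (𝟙 ((1 <ᵇ suc i) ∧ (suc i <ᵇ suc j)) * 𝟙 (I j i)))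

patternSum : ℕ → (ℕ → Bool) → (ℕ → ℕ → Bool) → ℕ
patternSum n S I = ∑[ j < n ] patternTerm n S I j

patternTerm-cong : ∀ n S S′ I I′ j → S j ≡ S′ j → (∀ i → I j i ≡ I′ j i) →
  patternTerm n S I j ≡ patternTerm n S′ I′ j
patternTerm-cong n S S′ I I′ j eS eI = cong (λ z → 𝟙 (2 <ᵇ suc j) * z)
  (cong₂ _+_ (cong 𝟙 eS) (∑-cong n (λ i _ → cong (λ b → 𝟙 ((1 <ᵇ suc i) ∧ (suc i <ᵇ suc j)) * 𝟙 b) (eI i))))

patternTerm-false : ∀ n S I j → S j ≡ false → (∀ i → I j i ≡ false) → patternTerm n S I j ≡ 0
patternTerm-false n S I j eS eI rewrite eS =
  trans (cong (𝟙 (2 <ᵇ suc j) *_) (∑-zero n (λ i → trans (cong (λ b → 𝟙 ((1 <ᵇ suc i) ∧ (suc i <ᵇ suc j)) * 𝟙 b) (eI i))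
                                                        (*-zeroʳ (𝟙 ((1 <ᵇ suc i) ∧ (suc i <ᵇ suc j)))))))
        (*-zeroʳ (𝟙 (2 <ᵇ suc j)))

patternSum-single : ∀ n S I y → y < n → (∀ j → (j ≡ᵇ y) ≡ false → S j ≡ false × (∀ i → I j i ≡ false)) →
  patternSum n S I ≡ patternTerm n S I y
patternSum-single n S I y y<n h =
  ∑-single n y (patternTerm n S I) y<n (λ j ne → patternTerm-false n S I j (proj₁ (h j ne)) (proj₂ (h j ne)))

endsIn1j : List ℕ → ℕ → Bool
endsIn1j l j = isSuffixOf (1 ∷ suc j ∷ []) l

contains1ji : List ℕ → ℕ → ℕ → Bool
contains1ji l j i = isInfixOf (1 ∷ suc j ∷ suc i ∷ []) l

descentTerm : ℕ → Bool → List ℕ → ℕ → ℕ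
descentTerm n g l = patternTerm n (λ j → g ∧ endsIn1j l j) (λ j i → g ∧ contains1ji l j i)

descentPatterns : ℕ → Bool → List ℕ → ℕ
descentPatterns n g l = ∑[ j < n ] descentTerm n g l j

endsRunAbove2≡patternSum : ∀ n xs → Letters n xs → notElem 1 xs ≡ true →
  𝟙 (endsRunAbove2 xs) ≡ patternSum n (λ j → sameList (suc j ∷ []) xs) (λ j i → isPrefixOf (suc j ∷ suc i ∷ []) xs)
endsRunAbove2≡patternSum n [] _ _ = sym (∑-zero n (λ j → patternTerm-false n _ _ j refl (λ _ → refl)))
endsRunAbove2≡patternSum n (suc y ∷ []) ((_ , y<n) ∷ []) _ = sym (begin
  patternSum n S I   ≡⟨ patternSum-single n S I y y<n (λ j ne → cong (_∧ true) ne , λ i → cong (_∧ false) ne) ⟩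
  patternTerm n S I y
    ≡⟨ patternTerm-cong n S (λ _ → true) I (λ _ _ → false) y (cong (_∧ true) (≡ᵇ-refl y)) (λ i → cong (_∧ false) (≡ᵇ-refl y)) ⟩
  𝟙 (2 <ᵇ suc y) * (1 + ∑[ i < n ] (𝟙 ((1 <ᵇ suc i) ∧ (suc i <ᵇ suc y)) * 0))
    ≡⟨ cong (λ z → 𝟙 (2 <ᵇ suc y) * suc z) (∑-zero n (λ i → *-zeroʳ (𝟙 ((1 <ᵇ suc i) ∧ (suc i <ᵇ suc y))))) ⟩
  𝟙 (2 <ᵇ suc y) * 1 ≡⟨ *-identityʳ _ ⟩
  𝟙 (2 <ᵇ suc y)     ∎)
  where
  open ≡-Reasoning
  S : ℕ → Bool
  S j = sameList (suc j ∷ []) (suc y ∷ [])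
  I : ℕ → ℕ → Bool
  I j i = isPrefixOf (suc j ∷ suc i ∷ []) (suc y ∷ [])
endsRunAbove2≡patternSum n (_ ∷ zero ∷ _) (_ ∷ (() , _) ∷ _) _
endsRunAbove2≡patternSum n (suc y ∷ suc zero ∷ r) _ ne rewrite ≡ᵇ-sym 0 y with y ≡ᵇ 0
... | true  = ⊥-elim (false≢true ne)
... | false = ⊥-elim (false≢true ne)
endsRunAbove2≡patternSum n (suc y ∷ suc (suc z) ∷ r) ((_ , y<n) ∷ (_ , z<n) ∷ _) _ = sym (begin
  patternSum n S I
    ≡⟨ patternSum-single n S I y y<n (λ j ne → cong (_∧ false) ne , λ i → cong (_∧ ((i ≡ᵇ suc z) ∧ true)) ne) ⟩
  patternTerm n S I y
    ≡⟨ patternTerm-cong n S (λ _ → false) I (λ _ i → (i ≡ᵇ suc z) ∧ true) y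
                        (cong (_∧ false) (≡ᵇ-refl y)) (λ i → cong (_∧ ((i ≡ᵇ suc z) ∧ true)) (≡ᵇ-refl y)) ⟩
  𝟙 (2 <ᵇ suc y) * (0 + ∑[ i < n ] (𝟙 ((1 <ᵇ suc i) ∧ (suc i <ᵇ suc y)) * 𝟙 ((i ≡ᵇ suc z) ∧ true)))
    ≡⟨ cong (𝟙 (2 <ᵇ suc y) *_) (∑-single n (suc z) _ z<n onlyZ) ⟩
  𝟙 (2 <ᵇ suc y) * (𝟙 (suc (suc z) <ᵇ suc y) * 𝟙 ((suc z ≡ᵇ suc z) ∧ true))
    ≡⟨ cong (λ b → 𝟙 (2 <ᵇ suc y) * (𝟙 (suc (suc z) <ᵇ suc y) * 𝟙 b)) (trans (∧-identityʳ _) (≡ᵇ-refl z)) ⟩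
  𝟙 (2 <ᵇ suc y) * (𝟙 (suc (suc z) <ᵇ suc y) * 1)
    ≡⟨ cong (𝟙 (2 <ᵇ suc y) *_) (*-identityʳ _) ⟩
  𝟙 (2 <ᵇ suc y) * 𝟙 (suc (suc z) <ᵇ suc y)
    ≡⟨ 𝟙-∧ (2 <ᵇ suc y) (suc (suc z) <ᵇ suc y) ⟨
  𝟙 (endsRunAbove2 (suc y ∷ suc (suc z) ∷ r)) ∎)
  where
  open ≡-Reasoning
  S : ℕ → Bool
  S j = sameList (suc j ∷ []) (suc y ∷ suc (suc z) ∷ r)
  I : ℕ → ℕ → Bool
  I j i = isPrefixOf (suc j ∷ suc i ∷ []) (suc y ∷ suc (suc z) ∷ r)
  onlyZ : ∀ i → (i ≡ᵇ suc z) ≡ false → 𝟙 ((1 <ᵇ suc i) ∧ (suc i <ᵇ suc y)) * 𝟙 ((i ≡ᵇ suc z) ∧ true) ≡ 0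
  onlyZ i ne rewrite ne = *-zeroʳ (𝟙 ((1 <ᵇ suc i) ∧ (suc i <ᵇ suc y)))

endsRunAbove2-afterOne≡descentPatterns : ∀ n l → distinct l ≡ true → Letters n l →
  𝟙 (endsRunAbove2 (afterOne l)) ≡ descentPatterns n true l
endsRunAbove2-afterOne≡descentPatterns n [] _ _ = sym (∑-zero n (λ j → patternTerm-false n _ _ j refl (λ _ → refl)))
endsRunAbove2-afterOne≡descentPatterns n (x ∷ xs) d (lx ∷ lxs) with x ≡ᵇ 1 in x≡1? | ∧-true {notElem x xs} d
... | false | _ , dxs = trans (endsRunAbove2-afterOne≡descentPatterns n xs dxs lxs)
  (∑-cong n (λ j _ → patternTerm-cong n (endsIn1j xs) (endsIn1j (x ∷ xs)) (contains1ji xs) (contains1ji (x ∷ xs)) j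
                       (cong (_∨ endsIn1j xs j) notHere) (λ i → cong (_∨ contains1ji xs j i) notHere)))
  where
  notHere : ∀ {b} → false ≡ (1 ≡ᵇ x) ∧ b
  notHere = sym (cong (_∧ _) (trans (≡ᵇ-sym 1 x) x≡1?))
... | true | 1∉xs , _ with refl ← ≡ᵇ-true⇒≡ x 1 x≡1? = trans (endsRunAbove2≡patternSum n xs lxs 1∉xs)
  (∑-cong n (λ j _ → patternTerm-cong n (λ j → sameList (suc j ∷ []) xs) (endsIn1j (1 ∷ xs))
                                         (λ j i → isPrefixOf (suc j ∷ suc i ∷ []) xs) (contains1ji (1 ∷ xs)) j
    (sym (trans (cong (sameList (suc j ∷ []) xs ∨_) (notElem⇒¬isSuffixOf 1 (suc j ∷ []) xs 1∉xs))
                (∨-identityʳ (sameList (suc j ∷ []) xs))))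
    (λ i → sym (trans (cong (isPrefixOf (suc j ∷ suc i ∷ []) xs ∨_) (notElem⇒¬isInfixOf 1 (suc j ∷ suc i ∷ []) xs 1∉xs))
                      (∨-identityʳ (isPrefixOf (suc j ∷ suc i ∷ []) xs))))))

-- Counting the permutations with a descent

¬disjoint⇒∈ : ∀ l x → disjoint l (x ∷ []) ≡ false → x ∈ l
¬disjoint⇒∈ (y ∷ ys) x d with y ≡ᵇ x in e
... | true  = here (sym (≡ᵇ-true⇒≡ y x e))
... | false = there (¬disjoint⇒∈ ys x d)

split-at-1 : ∀ l → disjoint l (1 ∷ []) ≡ false → ∃₂ λ p xs → l ≡ p ++ 1 ∷ xs × disjoint p (1 ∷ []) ≡ true
split-at-1 (y ∷ ys) d with y ≡ᵇ 1 in e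
... | true  = [] , ys , cong (_∷ ys) (≡ᵇ-true⇒≡ y 1 e) , refl
... | false with split-at-1 ys d
...   | p , xs , refl , p∌1 = y ∷ p , xs , refl , trans (cong (λ b → (if b then false else true) ∧ disjoint p (1 ∷ [])) e) p∌1

descentAt2-runsort : ∀ l → All (1 ≤_) l → distinct l ≡ true → 2 ∈ l → disjoint l (1 ∷ []) ≡ false →
  descentAt2 (runsort l) ≡ endsRunAbove2 (afterOne l)
descentAt2-runsort l pos dist two∈ has1 with split-at-1 l has1
... | p , xs , refl , p∌1 = trans (descentAt2-runsort-++ p xs pos dist two∈ p∌1) (cong endsRunAbove2 (sym (afterOne-++ p xs p∌1)))

freshFrom-[] : ∀ l → freshFrom [] l ≡ distinct l
freshFrom-[] l = trans (freshFrom≡distinct∧disjoint [] l) (trans (cong (distinct l ∧_) (disjoint-[] l)) (∧-identityʳ _))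

descent≡descentPatterns : ∀ n → 2 ≤ n → ∀ l → Letters n l → length l ≡ n →
  𝟙 (distinct l ∧ descentAt2 (runsort l)) ≡ descentPatterns n (freshFrom [] l) l
descent≡descentPatterns n 2≤n l ll len rewrite freshFrom-[] l with distinct l in dl
... | false = sym (∑-zero n (λ j → patternTerm-false n _ _ j refl (λ _ → refl)))
... | true  = trans (cong 𝟙 (descentAt2-runsort l (All.map proj₁ ll) dl two∈ has1))
                    (endsRunAbove2-afterOne≡descentPatterns n l dl ll)
  where
  has1 = injective-word-contains n l 1 ll len dl (s≤s z≤n , ≤-trans (s≤s z≤n) 2≤n)
  two∈ = ¬disjoint⇒∈ l 2 (injective-word-contains n l 2 ll len dl (s≤s z≤n , 2≤n))

sumWords-patternTerm : ∀ n m (S : List ℕ → ℕ → Bool) (I : List ℕ → ℕ → ℕ → Bool) j →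
  sumWords n m (λ l → patternTerm n (S l) (I l) j)
    ≡ 𝟙 (1 <ᵇ j) * (sumWords n m (λ l → 𝟙 (S l j))
                    + ∑[ i < n ] (𝟙 ((0 <ᵇ i) ∧ (i <ᵇ j)) * sumWords n m (λ l → 𝟙 (I l j i))))
sumWords-patternTerm n m S I j = begin
  sumWords n m (λ l → patternTerm n (S l) (I l) j)
    ≡⟨ sumWords-*ˡ n m (𝟙 (1 <ᵇ j)) _ ⟩
  𝟙 (1 <ᵇ j) * sumWords n m (λ l → 𝟙 (S l j) + ∑[ i < n ] (c i * 𝟙 (I l j i)))
    ≡⟨ cong (𝟙 (1 <ᵇ j) *_) (sumWords-+ n m _ _) ⟩
  𝟙 (1 <ᵇ j) * (sumWords n m (λ l → 𝟙 (S l j)) + sumWords n m (λ l → ∑[ i < n ] (c i * 𝟙 (I l j i))))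
    ≡⟨ cong (λ z → 𝟙 (1 <ᵇ j) * (sumWords n m (λ l → 𝟙 (S l j)) + z))
            (trans (sumWords-∑ n m n _) (∑-cong n (λ i _ → sumWords-*ˡ n m (c i) _))) ⟩
  𝟙 (1 <ᵇ j) * (sumWords n m (λ l → 𝟙 (S l j)) + ∑[ i < n ] (c i * sumWords n m (λ l → 𝟙 (I l j i)))) ∎
  where
  open ≡-Reasoning
  c : ℕ → ℕ
  c i = 𝟙 ((0 <ᵇ i) ∧ (i <ᵇ j))

∑-weights-above1 : ∀ k → ∑[ j < suc (suc k) ] (𝟙 (1 <ᵇ j) * j) * 2 ≡ k * (k + 3)
∑-weights-above1 zero    = refl
∑-weights-above1 (suc k) = begin
  ∑[ j < suc (suc (suc k)) ] (𝟙 (1 <ᵇ j) * j) * 2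
    ≡⟨ cong (_* 2) (∑-snoc (suc (suc k)) (λ j → 𝟙 (1 <ᵇ j) * j)) ⟩
  (Σw + 1 * suc (suc k)) * 2
    ≡⟨ *-distribʳ-+ 2 Σw _ ⟩
  Σw * 2 + 1 * suc (suc k) * 2
    ≡⟨ cong (_+ 1 * suc (suc k) * 2) (∑-weights-above1 k) ⟩
  k * (k + 3) + 1 * suc (suc k) * 2
    ≡⟨ solve 1 (λ k → k :* (k :+ con 3) :+ con 1 :* (con 2 :+ k) :* con 2 := (con 1 :+ k) :* ((con 1 :+ k) :+ con 3)) refl k ⟩
  suc k * (suc k + 3) ∎
  where
  open ≡-Reasoning
  Σw = ∑[ j < suc (suc k) ] (𝟙 (1 <ᵇ j) * j)

module PermutationsOf (m : ℕ) where

  n : ℕ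
  n = suc (suc (suc m))

  distinct-1j : ∀ j → 1 < j → distinct (1 ∷ suc j ∷ []) ≡ true
  distinct-1j (suc zero)    (s≤s ())
  distinct-1j (suc (suc j)) _ = refl

  distinct-1ji : ∀ j i → 0 < i → i < j → distinct (1 ∷ suc j ∷ suc i ∷ []) ≡ true
  distinct-1ji (suc zero)    (suc i) _ (s≤s ())
  distinct-1ji (suc (suc j)) (suc i) _ i<j rewrite ≢⇒≡ᵇ-false {suc j} {i} (λ e → <-irrefl (sym e) (≤-pred i<j)) = refl

  count-endsIn1j : ∀ j → 1 < j → j < n → sumWords n n (λ l → 𝟙 (freshFrom [] l ∧ endsIn1j l j)) ≡ suc m !
  count-endsIn1j j 1<j j<n = trans (Factor.count-suffix n 0 (suc j ∷ []) (s≤s z≤n) ((s≤s z≤n , j<n) ∷ []) (distinct-1j j 1<j)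
                                      (suc m) [] refl refl [])
                                   (falling-! (suc m))

  count-contains1ji : ∀ j i → 0 < i → i < j → j < n →
    sumWords n n (λ l → 𝟙 (freshFrom [] l ∧ contains1ji l j i)) ≡ suc m !
  count-contains1ji j i 0<i i<j j<n =
    trans (Factor.count-infix n 0 (suc j ∷ suc i ∷ []) (s≤s z≤n) ((s≤s z≤n , j<n) ∷ (s≤s z≤n , <-trans i<j j<n) ∷ [])
                              (distinct-1ji j i 0<i i<j) m [] refl refl [])
          (cong (suc m *_) (falling-! m))

  K : ℕ
  K = suc m !

  count-descentTerm : ∀ j → j < n → sumWords n n (λ l → descentTerm n (freshFrom [] l) l j) ≡ 𝟙 (1 <ᵇ j) * j * K
  count-descentTerm j j<n = begin
    sumWords n n (λ l → descentTerm n (freshFrom [] l) l j)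
      ≡⟨ sumWords-patternTerm n n (λ l j → freshFrom [] l ∧ endsIn1j l j) (λ l j i → freshFrom [] l ∧ contains1ji l j i) j ⟩
    𝟙 (1 <ᵇ j) * (ends + ∑[ i < n ] (𝟙 (between i) * contains i))
      ≡⟨ 𝟙-*-cong (1 <ᵇ j) (λ 1<j → occurrences (<ᵇ⇒<′ {1} {j} 1<j)) ⟩
    𝟙 (1 <ᵇ j) * (j * K)
      ≡⟨ *-assoc (𝟙 (1 <ᵇ j)) j K ⟨
    𝟙 (1 <ᵇ j) * j * K ∎
    where
    open ≡-Reasoning
    between : ℕ → Bool
    between i = (0 <ᵇ i) ∧ (i <ᵇ j)
    ends : ℕ
    ends = sumWords n n (λ l → 𝟙 (freshFrom [] l ∧ endsIn1j l j))
    contains : ℕ → ℕ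
    contains i = sumWords n n (λ l → 𝟙 (freshFrom [] l ∧ contains1ji l j i))

    count-between : ∀ j → j < n → ∑[ i < n ] 𝟙 ((0 <ᵇ i) ∧ (i <ᵇ j)) ≡ j ∸ 1
    count-between zero    _         = ∑-zero n (λ _ → refl)
    count-between (suc j) (s≤s j<n) = ∑-count-< (suc (suc m)) j (<⇒≤ j<n)

    K+[j-1]K : ∀ j → 1 < j → K + (j ∸ 1) * K ≡ j * K
    K+[j-1]K (suc j) _ = refl

    occurrences : 1 < j → ends + ∑[ i < n ] (𝟙 (between i) * contains i) ≡ j * K
    occurrences 1<j = begin
      ends + ∑[ i < n ] (𝟙 (between i) * contains i)
        ≡⟨ cong₂ _+_ (count-endsIn1j j 1<j j<n) (∑-cong n (λ i _ → 𝟙-*-cong (between i) (containsK i))) ⟩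
      K + ∑[ i < n ] (𝟙 (between i) * K)
        ≡⟨ cong (K +_) (trans (∑-*ʳ n K (𝟙 ∘ between)) (cong (_* K) (count-between j j<n))) ⟩
      K + (j ∸ 1) * K
        ≡⟨ K+[j-1]K j 1<j ⟩
      j * K ∎
      where
      containsK : ∀ i → between i ≡ true → contains i ≡ K
      containsK i 0<i<j with ∧-true {0 <ᵇ i} 0<i<j
      ... | 0<i , i<j = count-contains1ji j i (<ᵇ⇒<′ 0<i) (<ᵇ⇒<′ {i} {j} i<j) j<n

  B≡weights*K : B n ≡ ∑[ j < n ] (𝟙 (1 <ᵇ j) * j) * K
  B≡weights*K = begin
    B n
      ≡⟨ B≡sumWords n ⟩
    sumWords n n (λ l → 𝟙 (distinct l ∧ descentAt2 (runsort l)))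
      ≡⟨ sumWords-cong n n (descent≡descentPatterns n (s≤s (s≤s z≤n))) ⟩
    sumWords n n (λ l → descentPatterns n (freshFrom [] l) l)
      ≡⟨ sumWords-∑ n n n (λ j l → descentTerm n (freshFrom [] l) l j) ⟩
    ∑[ j < n ] sumWords n n (λ l → descentTerm n (freshFrom [] l) l j)
      ≡⟨ ∑-cong n count-descentTerm ⟩
    ∑[ j < n ] (𝟙 (1 <ᵇ j) * j * K)
      ≡⟨ ∑-*ʳ n K (λ j → 𝟙 (1 <ᵇ j) * j) ⟩
    ∑[ j < n ] (𝟙 (1 <ᵇ j) * j) * K ∎
    where open ≡-Reasoning

  twice-B : B n * 2 ≡ K * (n + 1) * suc m
  twice-B = begin
    B n * 2                           ≡⟨ cong (_* 2) B≡weights*K ⟩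
    Σw * K * 2                        ≡⟨ solve 2 (λ t k → t :* k :* con 2 := k :* (t :* con 2)) refl Σw K ⟩
    K * (Σw * 2)                      ≡⟨ cong (K *_) (∑-weights-above1 (suc m)) ⟩
    K * (suc m * (suc m + 3))         ≡⟨ solve 2 (λ m k → k :* ((con 1 :+ m) :* ((con 1 :+ m) :+ con 3))
                                                        := k :* ((con 3 :+ m) :+ con 1) :* (con 1 :+ m)) refl m K ⟩
    K * (n + 1) * suc m               ∎
    where
    open ≡-Reasoning
    Σw = ∑[ j < n ] (𝟙 (1 <ᵇ j) * j)

B-closed : ∀ n → 3 ≤ n → B n ≡ ((n ∸ 2) ! * (n + 1) * (n ∸ 2)) / 2
B-closed 1 (s≤s ())
B-closed 2 (s≤s (s≤s ()))
B-closed (suc (suc (suc m))) _ = sym (trans (cong (_/ 2) (sym (PermutationsOf.twice-B m))) (m*n/n≡m _ 2))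

B-recurrence : ∀ n → 4 ≤ n → B n ≡ (n ∸ 1) ! + (n ∸ 2) * B (n ∸ 1)
B-recurrence 1 (s≤s ())
B-recurrence 2 (s≤s (s≤s ()))
B-recurrence 3 (s≤s (s≤s (s≤s ())))
B-recurrence (suc (suc (suc (suc m)))) _ = *-cancelʳ-≡ _ _ 2 (begin
  B (4 + m) * 2
    ≡⟨ PermutationsOf.twice-B (suc m) ⟩
  (2 + m) ! * (4 + m + 1) * (2 + m)
    ≡⟨ solve 2 (λ m f → (con 2 :+ m) :* f :* ((con 4 :+ m) :+ con 1) :* (con 2 :+ m)
                        := (con 3 :+ m) :* ((con 2 :+ m) :* f) :* con 2 :+ (con 2 :+ m) :* (f :* ((con 3 :+ m) :+ con 1) :* (con 1 :+ m)))
               refl m ((1 + m) !) ⟩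
  (3 + m) ! * 2 + (2 + m) * ((1 + m) ! * (3 + m + 1) * (1 + m))
    ≡⟨ cong (λ z → (3 + m) ! * 2 + (2 + m) * z) (PermutationsOf.twice-B m) ⟨
  (3 + m) ! * 2 + (2 + m) * (B (3 + m) * 2)
    ≡⟨ solve 3 (λ a b c → a :* con 2 :+ b :* (c :* con 2) := (a :+ b :* c) :* con 2) refl ((3 + m) !) (2 + m) (B (3 + m)) ⟩
  ((3 + m) ! + (2 + m) * B (3 + m)) * 2 ∎)
  where open ≡-Reasoning

proposition4p18 : (B 3 ≡ 2)
    × (∀ n → 4 ≤ n → B n ≡ (n ∸ 1) ! + (n ∸ 2) * B (n ∸ 1))
    × (∀ n → 3 ≤ n → B n ≡ ((n ∸ 2) ! * (n + 1) * (n ∸ 2)) / 2)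
proposition4p18 = B-closed 3 (s≤s (s≤s (s≤s z≤n))) , B-recurrence , B-closed
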